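{- For all $M,N$: if $M\in\Lambda_{\circledR}$ and $M\to N$, then $N\in\Lambda_{\circledR}$; and if $M\in\Lambda_{\circledR}$ and $M\twoheadrightarrow N$, then $N\in\Lambda_{\circledR}$.
   Context: Fix a countably infinite set of variables. The set $\Lambda_{\circledR}$ of terms and $Fv(M)$ are defined simultaneously: every variable $x$ is a term with $Fv(x)=\{x\}$; $\lambda x.M$ is a term if $M$ is a term and $x\in Fv(M)$ ($Fv=Fv(M)\setminus\{x\}$); $MN$ is a term if $M,N$ are terms with $Fv(M)\cap Fv(N)=\emptyset$ ($Fv=Fv(M)\cup Fv(N)$); $x\odot M$ (erasure) is a term if $M$ is a term and $x\notin Fv(M)$ ($Fv=\{x\}\cup Fv(M)$); $x<^{x_1}_{x_2}M$ (duplication) is a term if $M$ is a term, $x_1,x_2\in Fv(M)$, $x_1\neq x_2$, $x\notin Fv(M)\setminus\{x_1,x_2\}$ ($Fv=\{x\}\cup(Fv(M)\setminus\{x_1,x_2\})$). $\lambda x$ binds $x$, duplication binds $x_1,x_2$; $\alpha$-conversion and Barendregt's convention are assumed. $Fv[M]$ is the ordered list of free variables; $X\odot M$ and $X<^{Y}_{Z}M$ denote iterated erasures/duplications over lists. Substitution $M\langle N/x\rangle$ (for $M,N\in\Lambda_{\circledR}$, $x\in Fv(M)$, $(Fv(M)\setminus\{x\})\cap Fv(N)=\emptyset$) is the unique normal form of the explicit substitution $M[N/x]$ under the rules: $x[N/x]\to N$; $(\lambda y.M)[N/x]\to\lambda y.M[N/x]$ ($y\ne x$); $(MP)[N/x]\to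 M[N/x]P$ if $x\in Fv(M)$; $(MP)[N/x]\to M\,P[N/x]$ if $x\in Fv(P)$; $(y\odot M)[N/x]\to y\odot M[N/x]$ ($y\neq x$); $(x\odot M)[N/x]\to Fv(N)\odot M$; $(y<^{y_1}_{y_2}M)[N/x]\to y<^{y_1}_{y_2}M[N/x]$ ($y\ne x$); $(x<^{x_1}_{x_2}M)[N/x]\to Fv[N]<^{Fv[N_1]}_{Fv[N_2]}M[N_1/x_1][N_2/x_2]$ ($N_1,N_2$ fresh renamings of $N$). Reduction $\rightarrow$ is the contextual closure, modulo structural equivalence, of: $(\lambda x.M)N\to M\langle N/x\rangle$; $x<^{x_1}_{x_2}(\lambda y.M)\to\lambda y.x<^{x_1}_{x_2}M$; $x<^{x_1}_{x_2}(MN)\to(x<^{x_1}_{x_2}M)N$ if $x_1,x_2\notin Fv(N)$; $x<^{x_1}_{x_2}(MN)\to M(x<^{x_1}_{x_2}N)$ if $x_1,x_2\notin Fv(M)$; $\lambda x.(y\odot M)\to y\odot(\lambda x.M)$ ($x\neq y$); $(x\odot M)N\to x\odot(MN)$; $M(x\odot N)\to x\odot(MN)$; $x<^{x_1}_{x_2}(y\odot M)\to y\odot(x<^{x_1}_{x_2}M)$ ($y\ne x_1,x_2$); $x<^{x_1}_{x_2}(x_1\odot M)\to M\langle x/x_2\rangle$. Structural equivalence is the least equivalence closed under $\alpha$-conversion containing $x\odot(y\odot M)\equiv y\odot(x\odot M)$; $x<^{x_1}_{x_2}M\equiv x<^{x_2}_{x_1}M$; $x<^{y}_{z}(y<^{u}_{v}M)\equiv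 x<^{y}_{u}(y<^{z}_{v}M)$; $x<^{x_1}_{x_2}(y<^{y_1}_{y_2}M)\equiv y<^{y_1}_{y_2}(x<^{x_1}_{x_2}M)$ if $x\ne y_1,y_2$, $y\ne x_1,x_2$. $\twoheadrightarrow$ is the reflexive-transitive closure of $\to$. -}

module Defs where

open import Data.Nat using (ℕ; _≡ᵇ_)
open import Data.Bool using (if_then_else_)
open import Data.List using (List; []; _∷_; _++_; length)
open import Data.List.Membership.Propositional using (_∈_; _∉_)
open import Data.List.Relation.Unary.Unique.Propositional using (Unique)
open import Data.Product using (Σ; _×_; ∃-syntax)
open import Data.Empty using (⊥)
open import Relation.Binary.PropositionalEquality using (_≡_; _≢_)
open import Relation.Binary.Construct.Closure.ReflexiveTransitive using (Star)

Var : Set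
Var = ℕ

-- Raw syntax.  `es M N x` is the explicit substitution M[N/x]
-- (binds x in M); it only occurs while computing M⟨N/x⟩, and is
-- not part of Λ® (WF below has no rule for it).
data Term : Set where
  var : Var → Term
  lam : Var → Term → Term
  app : Term → Term → Term
  era : Var → Term → Term                 -- x ⊙ M
  dup : Var → Var → Var → Term → Term     -- x <^{x1}_{x2} M
  es  : Term → Term → Var → Term

remove : Var → List Var → List Var
remove x [] = []
remove x (y ∷ ys) = if x ≡ᵇ y then remove x ys else (y ∷ remove x ys)

fv : Term → List Var
fv (var x) = x ∷ []
fv (lam x M) = remove x (fv M)
fv (app M N) = fv M ++ fv N
fv (era x M) = x ∷ fv M
fv (dup x x1 x2 M) = x ∷ remove x2 (remove x1 (fv M))
fv (es M N x) = remove x (fv M) ++ fv N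

vars : Term → List Var
vars (var x) = x ∷ []
vars (lam x M) = x ∷ vars M
vars (app M N) = vars M ++ vars N
vars (era x M) = x ∷ vars M
vars (dup x x1 x2 M) = x ∷ x1 ∷ x2 ∷ vars M
vars (es M N x) = x ∷ vars M ++ vars N

Disjoint : List Var → List Var → Set
Disjoint A B = ∀ z → z ∈ A → z ∈ B → ⊥

-- The set Λ® of (well-formed) terms.
data WF : Term → Set where
  wf-var : ∀ x → WF (var x)
  wf-lam : ∀ {x M} → WF M → x ∈ fv M → WF (lam x M)
  wf-app : ∀ {M N} → WF M → WF N → Disjoint (fv M) (fv N) → WF (app M N)
  wf-era : ∀ {x M} → WF M → x ∉ fv M → WF (era x M)
  wf-dup : ∀ {x x1 x2 M} → WF M → x1 ∈ fv M → x2 ∈ fv M → x1 ≢ x2 →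
           x ∉ remove x2 (remove x1 (fv M)) → WF (dup x x1 x2 M)

data Pure : Term → Set where
  p-var : ∀ x → Pure (var x)
  p-lam : ∀ {x M} → Pure M → Pure (lam x M)
  p-app : ∀ {M N} → Pure M → Pure N → Pure (app M N)
  p-era : ∀ {x M} → Pure M → Pure (era x M)
  p-dup : ∀ {x x1 x2 M} → Pure M → Pure (dup x x1 x2 M)

eras : List Var → Term → Term
eras [] M = M
eras (x ∷ xs) M = era x (eras xs M)

dups : List Var → List Var → List Var → Term → Term
dups (x ∷ X) (y ∷ Y) (z ∷ Z) M = dup x y z (dups X Y Z M)
dups _ _ _ M = M

-- renaming of the free variable x to y (capture-free when y ∉ vars M)
ren : Var → Var → Term → Term
ren x y (var z) = var (if z ≡ᵇ x then y else z)
ren x y (lam z M) = lam z (if z ≡ᵇ x then M else ren x y M)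
ren x y (app M N) = app (ren x y M) (ren x y N)
ren x y (era z M) = era (if z ≡ᵇ x then y else z) (ren x y M)
ren x y (dup z z1 z2 M) =
  dup (if z ≡ᵇ x then y else z) z1 z2
      (if z1 ≡ᵇ x then M else (if z2 ≡ᵇ x then M else ren x y M))
ren x y (es M N z) = es (if z ≡ᵇ x then M else ren x y M) (ren x y N) z

renames : List Var → List Var → Term → Term
renames (x ∷ X) (y ∷ Y) M = renames X Y (ren x y M)
renames _ _ M = M

FreshFor : List Var → Term → Term → Set
FreshFor Y N T = Unique Y × length Y ≡ length (fv N) × Disjoint Y (vars T)

-- One step of the explicit-substitution calculus (base rules).
-- Side conditions on binders express Barendregt's convention.
data _⇝₀_ : Term → Term → Set where
  s-var  : ∀ {x N} → es (var x) N x ⇝₀ N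
  s-lam  : ∀ {y M N x} → y ≢ x → y ∉ fv N →
           es (lam y M) N x ⇝₀ lam y (es M N x)
  s-appL : ∀ {M P N x} → x ∈ fv M → es (app M P) N x ⇝₀ app (es M N x) P
  s-appR : ∀ {M P N x} → x ∈ fv P → es (app M P) N x ⇝₀ app M (es P N x)
  s-era  : ∀ {y M N x} → y ≢ x → es (era y M) N x ⇝₀ era y (es M N x)
  s-eraX : ∀ {M N x} → es (era x M) N x ⇝₀ eras (fv N) M
  s-dup  : ∀ {y y1 y2 M N x} → y ≢ x → y1 ≢ x → y2 ≢ x → y1 ∉ fv N → y2 ∉ fv N →
           es (dup y y1 y2 M) N x ⇝₀ dup y y1 y2 (es M N x)
  s-dupX : ∀ {x1 x2 M N x} (Y Z : List Var) →
           FreshFor Y N (es (dup x x1 x2 M) N x) →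
           FreshFor Z N (es (dup x x1 x2 M) N x) → Disjoint Y Z →
           es (dup x x1 x2 M) N x ⇝₀
             dups (fv N) (fv (renames (fv N) Y N)) (fv (renames (fv N) Z N))
                  (es (es M (renames (fv N) Y N) x1) (renames (fv N) Z N) x2)

data _⇝_ : Term → Term → Set where
  e-base : ∀ {M N} → M ⇝₀ N → M ⇝ N
  e-lam  : ∀ {x M M'} → M ⇝ M' → lam x M ⇝ lam x M'
  e-appL : ∀ {M M' N} → M ⇝ M' → app M N ⇝ app M' N
  e-appR : ∀ {M N N'} → N ⇝ N' → app M N ⇝ app M N'
  e-era  : ∀ {x M M'} → M ⇝ M' → era x M ⇝ era x M'
  e-dup  : ∀ {x x1 x2 M M'} → M ⇝ M' → dup x x1 x2 M ⇝ dup x x1 x2 M'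
  e-esL  : ∀ {M M' N x} → M ⇝ M' → es M N x ⇝ es M' N x
  e-esR  : ∀ {M N N' x} → N ⇝ N' → es M N x ⇝ es M N' x

_⇝*_ : Term → Term → Set
_⇝*_ = Star _⇝_

-- Subst M N x P :  P = M⟨N/x⟩, defined for M,N ∈ Λ®, x ∈ Fv(M),
-- (Fv(M)∖{x}) ∩ Fv(N) = ∅, as the (ES-free) normal form of M[N/x].
Subst : Term → Term → Var → Term → Set
Subst M N x P =
  WF M × WF N × x ∈ fv M × Disjoint (remove x (fv M)) (fv N) ×
  (es M N x ⇝* P) × Pure P

data _≈_ : Term → Term → Set where
  ≈-refl  : ∀ {M} → M ≈ M
  ≈-sym   : ∀ {M N} → M ≈ N → N ≈ M
  ≈-trans : ∀ {M N P} → M ≈ N → N ≈ P → M ≈ P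
  ≈-lam   : ∀ {x M M'} → M ≈ M' → lam x M ≈ lam x M'
  ≈-app   : ∀ {M M' N N'} → M ≈ M' → N ≈ N' → app M N ≈ app M' N'
  ≈-era   : ∀ {x M M'} → M ≈ M' → era x M ≈ era x M'
  ≈-dup   : ∀ {x x1 x2 M M'} → M ≈ M' → dup x x1 x2 M ≈ dup x x1 x2 M'
  α-lam   : ∀ {x y M} → y ∉ vars (lam x M) → lam x M ≈ lam y (ren x y M)
  α-dup   : ∀ {x x1 x2 y M} → y ∉ vars (dup x x1 x2 M) →
            dup x x1 x2 M ≈ dup x y x2 (ren x1 y M)
  ax-era  : ∀ {x y M} → era x (era y M) ≈ era y (era x M)
  ax-swap : ∀ {x x1 x2 M} → dup x x1 x2 M ≈ dup x x2 x1 M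
  ax-assoc : ∀ {x y z u v M} → Unique (x ∷ y ∷ z ∷ u ∷ v ∷ []) →
             dup x y z (dup y u v M) ≈ dup x y u (dup y z v M)
  ax-comm : ∀ {x x1 x2 y y1 y2 M} → x ≢ y1 → x ≢ y2 → y ≢ x1 → y ≢ x2 →
            dup x x1 x2 (dup y y1 y2 M) ≈ dup y y1 y2 (dup x x1 x2 M)

data _⟶₀_ : Term → Term → Set where
  r-β      : ∀ {x M N P} → Subst M N x P → app (lam x M) N ⟶₀ P
  r-dupLam : ∀ {x x1 x2 y M} → y ≢ x → y ≢ x1 → y ≢ x2 →
             dup x x1 x2 (lam y M) ⟶₀ lam y (dup x x1 x2 M)
  r-dupAppL : ∀ {x x1 x2 M N} → x1 ∉ fv N → x2 ∉ fv N →
             dup x x1 x2 (app M N) ⟶₀ app (dup x x1 x2 M) N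
  r-dupAppR : ∀ {x x1 x2 M N} → x1 ∉ fv M → x2 ∉ fv M →
             dup x x1 x2 (app M N) ⟶₀ app M (dup x x1 x2 N)
  r-lamEra : ∀ {x y M} → x ≢ y → lam x (era y M) ⟶₀ era y (lam x M)
  r-eraAppL : ∀ {x M N} → app (era x M) N ⟶₀ era x (app M N)
  r-eraAppR : ∀ {x M N} → app M (era x N) ⟶₀ era x (app M N)
  r-dupEra : ∀ {x x1 x2 y M} → y ≢ x1 → y ≢ x2 →
             dup x x1 x2 (era y M) ⟶₀ era y (dup x x1 x2 M)
  r-dupGc  : ∀ {x x1 x2 M P} → Subst M (var x) x2 P →
             dup x x1 x2 (era x1 M) ⟶₀ P

data _⟶c_ : Term → Term → Set where
  c-base : ∀ {M N} → M ⟶₀ N → M ⟶c N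
  c-lam  : ∀ {x M M'} → M ⟶c M' → lam x M ⟶c lam x M'
  c-appL : ∀ {M M' N} → M ⟶c M' → app M N ⟶c app M' N
  c-appR : ∀ {M N N'} → N ⟶c N' → app M N ⟶c app M N'
  c-era  : ∀ {x M M'} → M ⟶c M' → era x M ⟶c era x M'
  c-dup  : ∀ {x x1 x2 M M'} → M ⟶c M' → dup x x1 x2 M ⟶c dup x x1 x2 M'

_⟶_ : Term → Term → Set
M ⟶ N = ∃[ M' ] ∃[ N' ] (M ≈ M' × M' ⟶c N' × N' ≈ N)

_↠_ : Term → Term → Set
_↠_ = Star _⟶_

-- Call a rewrite M ▷ N safe if N is well formed whenever M is and has the same
-- set of free variables.  Safety is closed under composition and under the term
-- constructors, so it suffices to check the base rules of reduction, the axioms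
-- of structural equivalence, and the rules of the explicit-substitution calculus
-- that computes M⟨N/x⟩ (the β-rule and garbage collection use M⟨N/x⟩).
-- The key observation is linearity: the free-variable list of a well-formed
-- term is duplicate-free (fv-unique).  Most rules merely permute that list, so
-- the side conditions (disjointness, freshness of binders) of the reduct are
-- read off from the duplicate-freeness of its free-variable list.

module Submission where

open import Defs
open import Data.Nat using (_≡ᵇ_; _≟_)
open import Data.Nat.Properties using (≡ᵇ⇒≡; ≡⇒≡ᵇ; suc-injective)
open import Data.Bool using (true; false; if_then_else_)
open import Data.List using (List; []; _∷_; _++_; length; map)
open import Data.List.Properties using (map-++; map-id; map-∘) renaming (++-assoc to List-++-assoc)
open import Data.List.Membership.Propositional using (_∈_; _∉_)
open import Data.List.Membership.Propositional.Properties using (∈-++⁺ˡ; ∈-++⁺ʳ; ∈-++⁻; ∈-map⁺; ∈-map⁻)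
open import Data.List.Relation.Unary.Any using (here; there)
open import Data.List.Relation.Unary.All as All using (All; []; _∷_)
open import Data.List.Relation.Unary.All.Properties using (¬Any⇒All¬) renaming (++⁻ˡ to All-++⁻ˡ; ++⁻ʳ to All-++⁻ʳ)
open import Data.List.Relation.Unary.AllPairs using ([]; _∷_)
open import Data.List.Relation.Unary.Unique.Propositional using (Unique)
open import Data.List.Relation.Unary.Unique.Propositional.Properties using () renaming (++⁺ to Unique-++⁺)
open import Data.List.Relation.Binary.Subset.Propositional using (_⊆_)
open import Data.List.Relation.Binary.Subset.Propositional.Properties using (∷⁺ʳ) renaming (++⁺ to ⊆-++⁺)
open import Data.List.Relation.Binary.Permutation.Propositional using (_↭_; ↭-refl; ↭-swap; ↭-sym; ↭-trans; ↭-reflexive; ↭⇒↭ₛ; module PermutationReasoning)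
open import Data.List.Relation.Binary.Permutation.Propositional.Properties using (∈-resp-↭; shift; ++-comm; ++-assoc; ++⁺ˡ)
import Data.List.Relation.Binary.Permutation.Setoid.Properties as PermutationSetoid
open import Data.Product using (_×_; _,_; proj₁; proj₂)
open import Data.Sum using (_⊎_; inj₁; inj₂; [_,_]′)
open import Data.Empty using (⊥; ⊥-elim)
open import Function using (id; _∘_)
open import Relation.Nullary using (yes; no)
open import Relation.Binary.PropositionalEquality
  using (_≡_; _≢_; refl; sym; trans; cong; cong₂; subst; subst₂; ≢-sym; setoid; module ≡-Reasoning)
open import Relation.Binary.Construct.Closure.ReflexiveTransitive using (ε; _◅_)

≡ᵇ-refl : ∀ x → (x ≡ᵇ x) ≡ true
≡ᵇ-refl x with x ≡ᵇ x | ≡⇒≡ᵇ x x refl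
... | true | _ = refl

≡ᵇ-≢ : ∀ {x y} → x ≢ y → (x ≡ᵇ y) ≡ false
≡ᵇ-≢ {x} {y} x≢y with x ≡ᵇ y | ≡ᵇ⇒≡ x y
... | true  | x≡y = ⊥-elim (x≢y (x≡y _))
... | false | _   = refl

∈-remove⁻ : ∀ {z x} L → z ∈ remove x L → z ∈ L × z ≢ x
∈-remove⁻ {x = x} (y ∷ L) p with x ≟ y
... | yes refl rewrite ≡ᵇ-refl x = let (q , z≢x) = ∈-remove⁻ L p in there q , z≢x
... | no x≢y rewrite ≡ᵇ-≢ x≢y with p
...   | here refl = here refl , ≢-sym x≢y
...   | there q   = let (q′ , z≢x) = ∈-remove⁻ L q in there q′ , z≢x

∈-remove⁺ : ∀ {z x} L → z ∈ L → z ≢ x → z ∈ remove x L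
∈-remove⁺ {x = x} (y ∷ L) p z≢x with x ≟ y
∈-remove⁺ (y ∷ L) (here refl) z≢x | yes refl = ⊥-elim (z≢x refl)
∈-remove⁺ (y ∷ L) (there p)   z≢x | yes refl rewrite ≡ᵇ-refl y = ∈-remove⁺ L p z≢x
∈-remove⁺ (y ∷ L) (here refl) z≢x | no x≢y rewrite ≡ᵇ-≢ x≢y = here refl
∈-remove⁺ (y ∷ L) (there p)   z≢x | no x≢y rewrite ≡ᵇ-≢ x≢y = there (∈-remove⁺ L p z≢x)

∈-remove₂⁻ : ∀ {z a b} L → z ∈ remove b (remove a L) → z ∈ L × z ≢ a × z ≢ b
∈-remove₂⁻ L p = let (p′ , z≢b) = ∈-remove⁻ _ p ; (p″ , z≢a) = ∈-remove⁻ L p′ in p″ , z≢a , z≢b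

∈-remove₂⁺ : ∀ {z a b} L → z ∈ L → z ≢ a → z ≢ b → z ∈ remove b (remove a L)
∈-remove₂⁺ L p z≢a z≢b = ∈-remove⁺ _ (∈-remove⁺ L p z≢a) z≢b

remove-here : ∀ x L → remove x (x ∷ L) ≡ remove x L
remove-here x L rewrite ≡ᵇ-refl x = refl

remove-there : ∀ {x y} L → x ≢ y → remove x (y ∷ L) ≡ y ∷ remove x L
remove-there L x≢y rewrite ≡ᵇ-≢ x≢y = refl

remove-++ : ∀ x A B → remove x (A ++ B) ≡ remove x A ++ remove x B
remove-++ x [] B = refl
remove-++ x (y ∷ A) B with x ≡ᵇ y
... | true  = remove-++ x A B
... | false = cong (y ∷_) (remove-++ x A B)

remove-comm : ∀ x y L → remove x (remove y L) ≡ remove y (remove x L)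
remove-comm x y [] = refl
remove-comm x y (z ∷ L) with x ≟ z | y ≟ z
... | yes refl | yes refl = refl
... | yes refl | no y≢z
  rewrite remove-there L y≢z | remove-here x (remove y L) | remove-here x L = remove-comm x y L
... | no x≢z | yes refl
  rewrite remove-there L x≢z | remove-here y (remove x L) | remove-here y L = remove-comm x y L
... | no x≢z | no y≢z
  rewrite remove-there L x≢z | remove-there L y≢z
        | remove-there (remove y L) x≢z | remove-there (remove x L) y≢z = cong (z ∷_) (remove-comm x y L)

remove-∉ : ∀ {x} L → x ∉ L → remove x L ≡ L
remove-∉ [] _ = refl
remove-∉ (y ∷ L) x∉ rewrite ≡ᵇ-≢ (x∉ ∘ here) = cong (y ∷_) (remove-∉ L (x∉ ∘ there))

remove₂-++ : ∀ a b A B → remove b (remove a (A ++ B)) ≡ remove b (remove a A) ++ remove b (remove a B)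
remove₂-++ a b A B = trans (cong (remove b) (remove-++ a A B)) (remove-++ b (remove a A) (remove a B))

remove₂-∉ : ∀ {a b} L → a ∉ L → b ∉ L → remove b (remove a L) ≡ L
remove₂-∉ {a} {b} L a∉ b∉ = trans (cong (remove b) (remove-∉ L a∉)) (remove-∉ L b∉)

remove-remove₂ : ∀ x a b L → remove x (remove b (remove a L)) ≡ remove b (remove a (remove x L))
remove-remove₂ x a b L = trans (remove-comm x b (remove a L)) (cong (remove b) (remove-comm x a L))

remove₂-there : ∀ {a b y} L → a ≢ y → b ≢ y → remove b (remove a (y ∷ L)) ≡ y ∷ remove b (remove a L)
remove₂-there {a} {b} L a≢y b≢y = trans (cong (remove b) (remove-there L a≢y)) (remove-there (remove a L) b≢y)

remove₂-comm : ∀ a b c d L → remove b (remove a (remove d (remove c L))) ≡ remove d (remove c (remove b (remove a L)))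
remove₂-comm a b c d L =
  trans (cong (remove b) (remove-remove₂ a c d L)) (remove-remove₂ b c d (remove a L))

∈-∷-≢ : ∀ {x y : Var} {L} → x ∈ y ∷ L → x ≢ y → x ∈ L
∈-∷-≢ (here x≡y) x≢y = ⊥-elim (x≢y x≡y)
∈-∷-≢ (there x∈L) _ = x∈L

∈-++-∉ʳ : ∀ {z : Var} A {B} → z ∈ A ++ B → z ∉ B → z ∈ A
∈-++-∉ʳ A p z∉B = [ id , ⊥-elim ∘ z∉B ]′ (∈-++⁻ A p)

∈-++-∉ˡ : ∀ {z : Var} A {B} → z ∈ A ++ B → z ∉ A → z ∈ B
∈-++-∉ˡ A p z∉A = [ ⊥-elim ∘ z∉A , id ]′ (∈-++⁻ A p)

-- Set equality of lists: same elements, order and multiplicity ignored.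
-- Free variable lists are only preserved in this sense by reduction.
infix 4 _≐_
_≐_ : List Var → List Var → Set
A ≐ B = A ⊆ B × B ⊆ A

≐-trans : ∀ {A B C} → A ≐ B → B ≐ C → A ≐ C
≐-trans (s , t) (s′ , t′) = s′ ∘ s , t ∘ t′

≡⇒≐ : ∀ {A B} → A ≡ B → A ≐ B
≡⇒≐ refl = id , id

↭⇒≐ : ∀ {A B} → A ↭ B → A ≐ B
↭⇒≐ p = ∈-resp-↭ p , ∈-resp-↭ (↭-sym p)

⊆-remove : ∀ {x A B} → A ⊆ B → remove x A ⊆ remove x B
⊆-remove {A = A} {B} s p = let (q , z≢x) = ∈-remove⁻ A p in ∈-remove⁺ B (s q) z≢x

≐-remove : ∀ {x A B} → A ≐ B → remove x A ≐ remove x B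
≐-remove (s , t) = ⊆-remove s , ⊆-remove t

≐-remove₂ : ∀ {a b A B} → A ≐ B → remove b (remove a A) ≐ remove b (remove a B)
≐-remove₂ = ≐-remove ∘ ≐-remove

≐-++ : ∀ {A A′ B B′} → A ≐ A′ → B ≐ B′ → A ++ B ≐ A′ ++ B′
≐-++ (s , t) (s′ , t′) = ⊆-++⁺ s s′ , ⊆-++⁺ t t′

≐-∷ : ∀ {x A B} → A ≐ B → x ∷ A ≐ x ∷ B
≐-∷ {x} (s , t) = ∷⁺ʳ x s , ∷⁺ʳ x t

Unique-resp-↭ : ∀ {A B : List Var} → A ↭ B → Unique A → Unique B
Unique-resp-↭ p = PermutationSetoid.Unique-resp-↭ (setoid Var) (↭⇒↭ₛ p)

Unique-remove : ∀ {x} L → Unique L → Unique (remove x L)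
Unique-remove [] [] = []
Unique-remove {x} (y ∷ L) (y∉L ∷ u) with x ≟ y
... | yes refl rewrite ≡ᵇ-refl x = Unique-remove L u
... | no x≢y rewrite ≡ᵇ-≢ x≢y =
  All.tabulate (λ p → All.lookup y∉L (proj₁ (∈-remove⁻ L p))) ∷ Unique-remove L u

Unique-++⁻ : ∀ A {B} → Unique (A ++ B) → Unique A × Unique B × Disjoint A B
Unique-++⁻ [] u = [] , u , λ _ ()
Unique-++⁻ (a ∷ A) {B} (a∉ ∷ u) =
  let (uA , uB , dj) = Unique-++⁻ A u in All-++⁻ˡ A a∉ ∷ uA , uB , disjoint dj
  where
  disjoint : Disjoint A B → Disjoint (a ∷ A) B
  disjoint dj z (here refl) q = All.lookup (All-++⁻ʳ A a∉) q refl
  disjoint dj z (there p)   q = dj z p q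

Unique-++⁻ˡ : ∀ A {B} → Unique (A ++ B) → Unique A
Unique-++⁻ˡ A u = proj₁ (Unique-++⁻ A u)

Unique-++⁻ʳ : ∀ A {B} → Unique (A ++ B) → Unique B
Unique-++⁻ʳ A u = proj₁ (proj₂ (Unique-++⁻ A u))

Unique-++⇒Disjoint : ∀ A {B} → Unique (A ++ B) → Disjoint A B
Unique-++⇒Disjoint A u = proj₂ (proj₂ (Unique-++⁻ A u))

Unique-∷⁻ : ∀ {x : Var} {L} → Unique (x ∷ L) → x ∉ L × Unique L
Unique-∷⁻ (x≢L ∷ uL) = (λ p → All.lookup x≢L p refl) , uL

↭-swap-tail : ∀ (A B C : List Var) → (A ++ B) ++ C ↭ (A ++ C) ++ B
↭-swap-tail A B C = begin
  (A ++ B) ++ C  ↭⟨ ++-assoc A B C ⟩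
  A ++ (B ++ C)  ↭⟨ ++⁺ˡ A (++-comm B C) ⟩
  A ++ (C ++ B)  ↭⟨ ++-assoc A C B ⟨
  (A ++ C) ++ B  ∎
  where open PermutationReasoning

-- Free variables and linearity

fv⊆vars : ∀ M → fv M ⊆ vars M
fv⊆vars (var x) p = p
fv⊆vars (lam x M) p = there (fv⊆vars M (proj₁ (∈-remove⁻ (fv M) p)))
fv⊆vars (app M N) p with ∈-++⁻ (fv M) p
... | inj₁ q = ∈-++⁺ˡ (fv⊆vars M q)
... | inj₂ q = ∈-++⁺ʳ (vars M) (fv⊆vars N q)
fv⊆vars (era x M) (here e) = here e
fv⊆vars (era x M) (there p) = there (fv⊆vars M p)
fv⊆vars (dup x x1 x2 M) (here e) = here e
fv⊆vars (dup x x1 x2 M) (there p) = there (there (there (fv⊆vars M (proj₁ (∈-remove₂⁻ (fv M) p)))))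
fv⊆vars (es M N x) p with ∈-++⁻ (remove x (fv M)) p
... | inj₁ q = there (∈-++⁺ˡ (fv⊆vars M (proj₁ (∈-remove⁻ (fv M) q))))
... | inj₂ q = there (∈-++⁺ʳ (vars M) (fv⊆vars N q))

∉vars⇒∉fv : ∀ {y} M → y ∉ vars M → y ∉ fv M
∉vars⇒∉fv M y∉ = y∉ ∘ fv⊆vars M

-- This is the invariant maintained while computing M⟨N/x⟩.
data WFₑ : Term → Set where
  we-var : ∀ x → WFₑ (var x)
  we-lam : ∀ {x M} → WFₑ M → x ∈ fv M → WFₑ (lam x M)
  we-app : ∀ {M N} → WFₑ M → WFₑ N → Disjoint (fv M) (fv N) → WFₑ (app M N)
  we-era : ∀ {x M} → WFₑ M → x ∉ fv M → WFₑ (era x M)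
  we-dup : ∀ {x x1 x2 M} → WFₑ M → x1 ∈ fv M → x2 ∈ fv M → x1 ≢ x2 →
           x ∉ remove x2 (remove x1 (fv M)) → WFₑ (dup x x1 x2 M)
  we-es  : ∀ {M N x} → WFₑ M → WF N → x ∈ fv M → Disjoint (remove x (fv M)) (fv N) →
           WFₑ (es M N x)

WF⇒WFₑ : ∀ {M} → WF M → WFₑ M
WF⇒WFₑ (wf-var x) = we-var x
WF⇒WFₑ (wf-lam w x∈) = we-lam (WF⇒WFₑ w) x∈
WF⇒WFₑ (wf-app wM wN dj) = we-app (WF⇒WFₑ wM) (WF⇒WFₑ wN) dj
WF⇒WFₑ (wf-era w x∉) = we-era (WF⇒WFₑ w) x∉
WF⇒WFₑ (wf-dup w x1∈ x2∈ x1≢x2 x∉) = we-dup (WF⇒WFₑ w) x1∈ x2∈ x1≢x2 x∉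

WFₑ⇒WF : ∀ {M} → WFₑ M → Pure M → WF M
WFₑ⇒WF (we-var x) _ = wf-var x
WFₑ⇒WF (we-lam w x∈) (p-lam p) = wf-lam (WFₑ⇒WF w p) x∈
WFₑ⇒WF (we-app wM wN dj) (p-app pM pN) = wf-app (WFₑ⇒WF wM pM) (WFₑ⇒WF wN pN) dj
WFₑ⇒WF (we-era w x∉) (p-era p) = wf-era (WFₑ⇒WF w p) x∉
WFₑ⇒WF (we-dup w x1∈ x2∈ x1≢x2 x∉) (p-dup p) = wf-dup (WFₑ⇒WF w p) x1∈ x2∈ x1≢x2 x∉

-- Conversely, the disjointness side conditions of a node follow from the
-- duplicate-freeness of its free variable list; this is how the side
-- conditions of a reduct are recovered below.
fv-unique : ∀ {M} → WFₑ M → Unique (fv M)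
fv-unique (we-var x) = [] ∷ []
fv-unique (we-lam w _) = Unique-remove _ (fv-unique w)
fv-unique (we-app wM wN dj) = Unique-++⁺ (fv-unique wM) (fv-unique wN) (λ (p , q) → dj _ p q)
fv-unique (we-era w x∉) = ¬Any⇒All¬ _ x∉ ∷ fv-unique w
fv-unique (we-dup w _ _ _ x∉) = ¬Any⇒All¬ _ x∉ ∷ Unique-remove _ (Unique-remove _ (fv-unique w))
fv-unique (we-es wM wN _ dj) =
  Unique-++⁺ (Unique-remove _ (fv-unique wM)) (fv-unique (WF⇒WFₑ wN)) (λ (p , q) → dj _ p q)

wf-unique : ∀ {M} → WF M → Unique (fv M)
wf-unique = fv-unique ∘ WF⇒WFₑ

-- Renaming a free variable to a fresh one

renVar : Var → Var → Var → Var
renVar x y z = if z ≡ᵇ x then y else z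

renVar-hit : ∀ x y → renVar x y x ≡ y
renVar-hit x y rewrite ≡ᵇ-refl x = refl

renVar-miss : ∀ {x y z} → z ≢ x → renVar x y z ≡ z
renVar-miss z≢x rewrite ≡ᵇ-≢ z≢x = refl

renVar-injective : ∀ {x y a b} → a ≢ y → b ≢ y → renVar x y a ≡ renVar x y b → a ≡ b
renVar-injective {x} {y} {a} {b} a≢y b≢y e with a ≟ x | b ≟ x
... | yes refl | yes refl = refl
... | yes refl | no b≢x rewrite renVar-hit a y | renVar-miss {x} {y} b≢x = ⊥-elim (b≢y (sym e))
... | no a≢x | yes refl rewrite renVar-hit b y | renVar-miss {x} {y} a≢x = ⊥-elim (a≢y e)
... | no a≢x | no b≢x rewrite renVar-miss {x} {y} a≢x | renVar-miss {x} {y} b≢x = e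

map-renVar-∉ : ∀ {x y} L → x ∉ L → map (renVar x y) L ≡ L
map-renVar-∉ [] _ = refl
map-renVar-∉ (w ∷ L) x∉ = cong₂ _∷_ (renVar-miss (x∉ ∘ here ∘ sym)) (map-renVar-∉ L (x∉ ∘ there))

remove-map-renVar : ∀ {x y z} L → z ≢ x → z ≢ y →
                    remove z (map (renVar x y) L) ≡ map (renVar x y) (remove z L)
remove-map-renVar [] _ _ = refl
remove-map-renVar {x} {y} {z} (w ∷ L) z≢x z≢y with w ≟ x
... | yes refl rewrite renVar-hit w y | ≡ᵇ-≢ z≢y | ≡ᵇ-≢ z≢x | renVar-hit w y =
  cong (y ∷_) (remove-map-renVar L z≢x z≢y)
... | no w≢x rewrite renVar-miss {x} {y} w≢x with z ≟ w
...   | yes refl rewrite ≡ᵇ-refl z = remove-map-renVar L z≢x z≢y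
...   | no z≢w rewrite ≡ᵇ-≢ z≢w | renVar-miss {x} {y} w≢x = cong (w ∷_) (remove-map-renVar L z≢x z≢y)

remove-map-renVar-fresh : ∀ {x y} L → y ∉ L → remove y (map (renVar x y) L) ≡ remove x L
remove-map-renVar-fresh [] _ = refl
remove-map-renVar-fresh {x} {y} (z ∷ L) y∉ with z ≟ x
... | yes refl rewrite ≡ᵇ-refl z | ≡ᵇ-refl y = remove-map-renVar-fresh L (y∉ ∘ there)
... | no z≢x rewrite ≡ᵇ-≢ z≢x | ≡ᵇ-≢ (y∉ ∘ here) | ≡ᵇ-≢ (≢-sym z≢x) =
  cong (z ∷_) (remove-map-renVar-fresh L (y∉ ∘ there))

∈-map-renVar⁺ : ∀ {x y z} L → z ∈ L → z ≢ x → z ∈ map (renVar x y) L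
∈-map-renVar⁺ {x} {y} L z∈ z≢x = subst (_∈ map (renVar x y) L) (renVar-miss z≢x) (∈-map⁺ (renVar x y) z∈)

∈-map-renVar⁻ : ∀ {x y z} L → z ∈ map (renVar x y) L → z ≢ y → z ∈ L × z ≢ x
∈-map-renVar⁻ {x} {y} L p z≢y with ∈-map⁻ (renVar x y) p
... | a , a∈ , refl with a ≟ x
...   | yes refl = ⊥-elim (z≢y (renVar-hit a y))
...   | no a≢x rewrite renVar-miss {x} {y} a≢x = a∈ , a≢x

renVar-∈-map⁻ : ∀ {x y w} L → y ∉ L → w ≢ y → renVar x y w ∈ map (renVar x y) L → w ∈ L
renVar-∈-map⁻ {x} {y} {w} L y∉ w≢y p with ∈-map⁻ (renVar x y) p
... | a , a∈ , e = subst (_∈ L) (sym (renVar-injective w≢y (λ a≡y → y∉ (subst (_∈ L) a≡y a∈)) e)) a∈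

fresh∈map⇒∈ : ∀ {x y} L → y ∉ L → y ∈ map (renVar x y) L → x ∈ L
fresh∈map⇒∈ {x} {y} L y∉ p with ∈-map⁻ (renVar x y) p
... | a , a∈ , e with a ≟ x
...   | yes refl = a∈
...   | no a≢x rewrite renVar-miss {x} {y} a≢x = ⊥-elim (y∉ (subst (_∈ L) (sym e) a∈))

∉-remove : ∀ {x} L → x ∉ remove x L
∉-remove L p = proj₂ (∈-remove⁻ L p) refl

fv-ren : ∀ {x y} M → y ∉ vars M → fv (ren x y M) ≡ map (renVar x y) (fv M)
fv-ren (var z) _ = refl
fv-ren {x} {y} (lam z M) y∉ with z ≟ x
... | yes refl rewrite ≡ᵇ-refl z = sym (map-renVar-∉ (remove z (fv M)) (∉-remove (fv M)))
... | no z≢x rewrite ≡ᵇ-≢ z≢x | fv-ren {x} {y} M (y∉ ∘ there) =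
  remove-map-renVar (fv M) z≢x (y∉ ∘ here ∘ sym)
fv-ren {x} {y} (app M N) y∉
  rewrite fv-ren {x} {y} M (y∉ ∘ ∈-++⁺ˡ) | fv-ren {x} {y} N (y∉ ∘ ∈-++⁺ʳ (vars M)) =
  sym (map-++ (renVar x y) (fv M) (fv N))
fv-ren {x} {y} (era z M) y∉ = cong (renVar x y z ∷_) (fv-ren M (y∉ ∘ there))
fv-ren {x} {y} (dup z z1 z2 M) y∉ with z1 ≟ x
... | yes refl rewrite ≡ᵇ-refl z1 =
  cong (renVar z1 y z ∷_) (sym (map-renVar-∉ _ (∉-remove (fv M) ∘ proj₁ ∘ ∈-remove⁻ _)))
... | no z1≢x rewrite ≡ᵇ-≢ z1≢x with z2 ≟ x
...   | yes refl rewrite ≡ᵇ-refl z2 =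
  cong (renVar z2 y z ∷_) (sym (map-renVar-∉ _ (∉-remove (remove z1 (fv M)))))
...   | no z2≢x rewrite ≡ᵇ-≢ z2≢x | fv-ren {x} {y} M (y∉ ∘ there ∘ there ∘ there)
        | remove-map-renVar {x} {y} (fv M) z1≢x (y∉ ∘ there ∘ here ∘ sym)
        | remove-map-renVar {x} {y} (remove z1 (fv M)) z2≢x (y∉ ∘ there ∘ there ∘ here ∘ sym) = refl
fv-ren {x} {y} (es M N z) y∉ with z ≟ x
... | yes refl rewrite ≡ᵇ-refl z | fv-ren {z} {y} N (y∉ ∘ there ∘ ∈-++⁺ʳ (vars M))
      | map-++ (renVar z y) (remove z (fv M)) (fv N) | map-renVar-∉ {z} {y} (remove z (fv M)) (∉-remove (fv M)) = refl
... | no z≢x rewrite ≡ᵇ-≢ z≢x | fv-ren {x} {y} N (y∉ ∘ there ∘ ∈-++⁺ʳ (vars M))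
      | fv-ren {x} {y} M (y∉ ∘ there ∘ ∈-++⁺ˡ)
      | map-++ (renVar x y) (remove z (fv M)) (fv N) | remove-map-renVar {x} {y} (fv M) z≢x (y∉ ∘ here ∘ sym) = refl

renVar-∈ : ∀ x y z {L} → renVar x y z ∈ y ∷ z ∷ L
renVar-∈ x y z with z ≡ᵇ x
... | true  = here refl
... | false = there (here refl)

vars-ren : ∀ {x y} M → vars (ren x y M) ⊆ y ∷ vars M
vars-ren {x} {y} (var z) (here refl) = renVar-∈ x y z
vars-ren (lam z M) (here refl) = there (here refl)
vars-ren {x} {y} (lam z M) (there p) with z ≡ᵇ x
... | true  = there (there p)
... | false = ∷⁺ʳ y there (vars-ren M p)
vars-ren {x} {y} (app M N) p with ∈-++⁻ (vars (ren x y M)) p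
... | inj₁ q = ∷⁺ʳ y ∈-++⁺ˡ (vars-ren M q)
... | inj₂ q = ∷⁺ʳ y (∈-++⁺ʳ (vars M)) (vars-ren N q)
vars-ren {x} {y} (era z M) (here refl) = renVar-∈ x y z
vars-ren {x} {y} (era z M) (there p) = ∷⁺ʳ y there (vars-ren M p)
vars-ren {x} {y} (dup z z1 z2 M) (here refl) = renVar-∈ x y z
vars-ren (dup z z1 z2 M) (there (here refl)) = there (there (here refl))
vars-ren (dup z z1 z2 M) (there (there (here refl))) = there (there (there (here refl)))
vars-ren {x} {y} (dup z z1 z2 M) (there (there (there p))) with z1 ≡ᵇ x
... | true = there (there (there (there p)))
... | false with z2 ≡ᵇ x
...   | true  = there (there (there (there p)))
...   | false = ∷⁺ʳ y (there ∘ there ∘ there) (vars-ren M p)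
vars-ren (es M N z) (here refl) = there (here refl)
vars-ren {x} {y} (es M N z) (there p) with z ≡ᵇ x
... | true with ∈-++⁻ (vars M) p
...   | inj₁ q = there (there (∈-++⁺ˡ q))
...   | inj₂ q = ∷⁺ʳ y (there ∘ ∈-++⁺ʳ (vars M)) (vars-ren N q)
vars-ren {x} {y} (es M N z) (there p) | false with ∈-++⁻ (vars (ren x y M)) p
...   | inj₁ q = ∷⁺ʳ y (there ∘ ∈-++⁺ˡ) (vars-ren M q)
...   | inj₂ q = ∷⁺ʳ y (there ∘ ∈-++⁺ʳ (vars M)) (vars-ren N q)

-- If x is one of the variables bound by a duplication, renaming leaves its body
-- untouched and can only change its head z, to the fresh y; the head's side
-- condition survives.
renVar-∉-bound : ∀ {x y z z1 z2 M} → y ∉ vars (dup z z1 z2 M) → z ∉ remove z2 (remove z1 (fv M)) →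
                 renVar x y z ∉ remove z2 (remove z1 (fv M))
renVar-∉-bound {x} {y} {z} {M = M} y∉ z∉ with z ≟ x
... | yes refl rewrite renVar-hit z y = ∉vars⇒∉fv M (y∉ ∘ there ∘ there ∘ there) ∘ proj₁ ∘ ∈-remove₂⁻ (fv M)
... | no z≢x rewrite renVar-miss {x} {y} z≢x = z∉

WF-ren⁺ : ∀ {x y} M → y ∉ vars M → WF M → WF (ren x y M)
WF-ren⁺ (var z) _ _ = wf-var _
WF-ren⁺ {x} {y} (lam z M) y∉ (wf-lam w z∈) with z ≟ x
... | yes refl rewrite ≡ᵇ-refl z = wf-lam w z∈
... | no z≢x rewrite ≡ᵇ-≢ z≢x =
  wf-lam (WF-ren⁺ M (y∉ ∘ there) w)
         (subst (z ∈_) (sym (fv-ren M (y∉ ∘ there))) (∈-map-renVar⁺ (fv M) z∈ z≢x))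
WF-ren⁺ {x} {y} (app M N) y∉ (wf-app wM wN dj) =
  wf-app (WF-ren⁺ M y∉M wM) (WF-ren⁺ N y∉N wN) disjoint
  where
  y∉M = y∉ ∘ ∈-++⁺ˡ
  y∉N = y∉ ∘ ∈-++⁺ʳ (vars M)
  disjoint : Disjoint (fv (ren x y M)) (fv (ren x y N))
  disjoint v p q rewrite fv-ren {x} {y} M y∉M | fv-ren {x} {y} N y∉N
    with ∈-map⁻ (renVar x y) p | ∈-map⁻ (renVar x y) q
  ... | a , a∈ , refl | b , b∈ , e =
    dj a a∈ (subst (_∈ fv N) (sym (renVar-injective (λ { refl → ∉vars⇒∉fv M y∉M a∈ })
                                                     (λ { refl → ∉vars⇒∉fv N y∉N b∈ }) e)) b∈)
WF-ren⁺ {x} {y} (era z M) y∉ (wf-era w z∉) =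
  wf-era (WF-ren⁺ M (y∉ ∘ there) w) z∉′
  where
  z∉′ : renVar x y z ∉ fv (ren x y M)
  z∉′ p rewrite fv-ren {x} {y} M (y∉ ∘ there) =
    z∉ (renVar-∈-map⁻ (fv M) (∉vars⇒∉fv M (y∉ ∘ there)) (y∉ ∘ here ∘ sym) p)
WF-ren⁺ {x} {y} (dup z z1 z2 M) y∉ (wf-dup w z1∈ z2∈ z1≢z2 z∉) with z1 ≟ x
... | yes refl rewrite ≡ᵇ-refl z1 = wf-dup w z1∈ z2∈ z1≢z2 (renVar-∉-bound {M = M} y∉ z∉)
... | no z1≢x rewrite ≡ᵇ-≢ z1≢x with z2 ≟ x
...   | yes refl rewrite ≡ᵇ-refl z2 = wf-dup w z1∈ z2∈ z1≢z2 (renVar-∉-bound {M = M} y∉ z∉)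
...   | no z2≢x rewrite ≡ᵇ-≢ z2≢x =
  wf-dup (WF-ren⁺ M y∉M w) (∈-fv-ren z1∈ z1≢x) (∈-fv-ren z2∈ z2≢x) z1≢z2 z∉′
  where
  y∉M = y∉ ∘ there ∘ there ∘ there
  ∈-fv-ren : ∀ {v} → v ∈ fv M → v ≢ x → v ∈ fv (ren x y M)
  ∈-fv-ren v∈ v≢x rewrite fv-ren {x} {y} M y∉M = ∈-map-renVar⁺ (fv M) v∈ v≢x
  z∉′ : renVar x y z ∉ remove z2 (remove z1 (fv (ren x y M)))
  z∉′ p rewrite fv-ren {x} {y} M y∉M
              | remove-map-renVar {x} {y} (fv M) z1≢x (y∉ ∘ there ∘ here ∘ sym)
              | remove-map-renVar {x} {y} (remove z1 (fv M)) z2≢x (y∉ ∘ there ∘ there ∘ here ∘ sym) =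
    z∉ (renVar-∈-map⁻ _ (∉vars⇒∉fv M y∉M ∘ proj₁ ∘ ∈-remove₂⁻ (fv M)) (y∉ ∘ here ∘ sym) p)

WF-ren⁻ : ∀ {x y} M → y ∉ vars M → WF (ren x y M) → WF M
WF-ren⁻ (var z) _ _ = wf-var z
WF-ren⁻ {x} {y} (lam z M) y∉ w with z ≟ x
... | yes refl rewrite ≡ᵇ-refl z = w
... | no z≢x rewrite ≡ᵇ-≢ z≢x with w
...   | wf-lam w′ z∈ =
  wf-lam (WF-ren⁻ M y∉M w′)
         (renVar-∈-map⁻ (fv M) (∉vars⇒∉fv M y∉M) (y∉ ∘ here ∘ sym)
            (subst (_∈ map (renVar x y) (fv M)) (sym (renVar-miss z≢x)) (subst (z ∈_) (fv-ren M y∉M) z∈)))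
  where y∉M = y∉ ∘ there
WF-ren⁻ {x} {y} (app M N) y∉ (wf-app wM wN dj) =
  wf-app (WF-ren⁻ M y∉M wM) (WF-ren⁻ N y∉N wN) disjoint
  where
  y∉M = y∉ ∘ ∈-++⁺ˡ
  y∉N = y∉ ∘ ∈-++⁺ʳ (vars M)
  disjoint : Disjoint (fv M) (fv N)
  disjoint v p q = dj (renVar x y v) (subst (renVar x y v ∈_) (sym (fv-ren M y∉M)) (∈-map⁺ (renVar x y) p))
                                     (subst (renVar x y v ∈_) (sym (fv-ren N y∉N)) (∈-map⁺ (renVar x y) q))
WF-ren⁻ {x} {y} (era z M) y∉ (wf-era w z∉) =
  wf-era (WF-ren⁻ M (y∉ ∘ there) w)
         (z∉ ∘ subst (renVar x y z ∈_) (sym (fv-ren M (y∉ ∘ there))) ∘ ∈-map⁺ (renVar x y))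
WF-ren⁻ {x} {y} (dup z z1 z2 M) y∉ w with z1 ≟ x
... | yes refl rewrite ≡ᵇ-refl z1 with w
...   | wf-dup w′ z1∈ z2∈ z1≢z2 z∉ = wf-dup w′ z1∈ z2∈ z1≢z2 (bound-∉ z∉)
  where
  bound-∉ : renVar z1 y z ∉ remove z2 (remove z1 (fv M)) → z ∉ remove z2 (remove z1 (fv M))
  bound-∉ z∉ with z ≟ z1
  ... | yes refl = ∉-remove (fv M) ∘ proj₁ ∘ ∈-remove⁻ _
  ... | no z≢z1 rewrite renVar-miss {z1} {y} z≢z1 = z∉
WF-ren⁻ {x} {y} (dup z z1 z2 M) y∉ w | no z1≢x rewrite ≡ᵇ-≢ z1≢x with z2 ≟ x
... | yes refl rewrite ≡ᵇ-refl z2 with w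
...   | wf-dup w′ z1∈ z2∈ z1≢z2 z∉ = wf-dup w′ z1∈ z2∈ z1≢z2 (bound-∉ z∉)
  where
  bound-∉ : renVar z2 y z ∉ remove z2 (remove z1 (fv M)) → z ∉ remove z2 (remove z1 (fv M))
  bound-∉ z∉ with z ≟ z2
  ... | yes refl = ∉-remove (remove z1 (fv M))
  ... | no z≢z2 rewrite renVar-miss {z2} {y} z≢z2 = z∉
WF-ren⁻ {x} {y} (dup z z1 z2 M) y∉ w | no z1≢x | no z2≢x rewrite ≡ᵇ-≢ z2≢x with w
... | wf-dup w′ z1∈ z2∈ z1≢z2 z∉ =
  wf-dup (WF-ren⁻ M y∉M w′) (∈-fv z1∈ z1≢x z1≢y) (∈-fv z2∈ z2≢x z2≢y) z1≢z2 z∉′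
  where
  y∉M = y∉ ∘ there ∘ there ∘ there
  z1≢y : z1 ≢ y
  z1≢y = y∉ ∘ there ∘ here ∘ sym
  z2≢y : z2 ≢ y
  z2≢y = y∉ ∘ there ∘ there ∘ here ∘ sym
  ∈-fv : ∀ {v} → v ∈ fv (ren x y M) → v ≢ x → v ≢ y → v ∈ fv M
  ∈-fv {v} v∈ v≢x v≢y =
    renVar-∈-map⁻ (fv M) (∉vars⇒∉fv M y∉M) v≢y
      (subst (_∈ map (renVar x y) (fv M)) (sym (renVar-miss v≢x)) (subst (v ∈_) (fv-ren M y∉M) v∈))
  z∉′ : z ∉ remove z2 (remove z1 (fv M))
  z∉′ p = z∉ (subst (λ L → renVar x y z ∈ remove z2 (remove z1 L)) (sym (fv-ren M y∉M))
                (subst (renVar x y z ∈_)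
                   (sym (trans (cong (remove z2) (remove-map-renVar (fv M) z1≢x z1≢y))
                               (remove-map-renVar (remove z1 (fv M)) z2≢x z2≢y)))
                   (∈-map⁺ (renVar x y) p)))

renVars : List Var → List Var → Var → Var
renVars (x ∷ X) (y ∷ Y) w = renVars X Y (renVar x y w)
renVars _ _ w = w

fresh-ren : ∀ {x y Y} N → All (y ≢_) Y → Disjoint Y (vars N) → Disjoint Y (vars (ren x y N))
fresh-ren N y∉Y dj w w∈Y w∈ with vars-ren N w∈
... | here refl = All.lookup y∉Y w∈Y refl
... | there q   = dj w w∈Y q

fv-renames : ∀ X Y N → Unique Y → Disjoint Y (vars N) → fv (renames X Y N) ≡ map (renVars X Y) (fv N)
fv-renames [] Y N _ _ = sym (map-id (fv N))
fv-renames (x ∷ X) [] N _ _ = sym (map-id (fv N))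
fv-renames (x ∷ X) (y ∷ Y) N (y∉Y ∷ uY) dj = begin
  fv (renames X Y (ren x y N))               ≡⟨ fv-renames X Y (ren x y N) uY (fresh-ren N y∉Y (λ w → dj w ∘ there)) ⟩
  map (renVars X Y) (fv (ren x y N))         ≡⟨ cong (map (renVars X Y)) (fv-ren N (dj y (here refl))) ⟩
  map (renVars X Y) (map (renVar x y) (fv N)) ≡⟨ map-∘ (fv N) ⟨
  map (renVars (x ∷ X) (y ∷ Y)) (fv N)       ∎
  where open ≡-Reasoning

WF-renames : ∀ X Y N → Unique Y → Disjoint Y (vars N) → WF N → WF (renames X Y N)
WF-renames [] Y N _ _ w = w
WF-renames (x ∷ X) [] N _ _ w = w
WF-renames (x ∷ X) (y ∷ Y) N (y∉Y ∷ uY) dj w =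
  WF-renames X Y (ren x y N) uY (fresh-ren N y∉Y (λ w → dj w ∘ there)) (WF-ren⁺ N (dj y (here refl)) w)

renVars-∉ : ∀ X Y w → w ∉ X → renVars X Y w ≡ w
renVars-∉ [] Y w _ = refl
renVars-∉ (x ∷ X) [] w _ = refl
renVars-∉ (x ∷ X) (y ∷ Y) w w∉ rewrite renVar-miss {x} {y} (w∉ ∘ here) = renVars-∉ X Y w (w∉ ∘ there)

map-renVars : ∀ X Y → Unique X → Disjoint X Y → length X ≡ length Y → map (renVars X Y) X ≡ Y
map-renVars [] [] _ _ _ = refl
map-renVars (x ∷ X) (y ∷ Y) (x∉X ∷ uX) dj len rewrite renVar-hit x y =
  cong₂ _∷_ (renVars-∉ X Y y (λ y∈X → dj y (there y∈X) (here refl)))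
    (trans (map-∘ X)
      (trans (cong (map (renVars X Y)) (map-renVar-∉ X (λ x∈X → All.lookup x∉X x∈X refl)))
        (map-renVars X Y uX (λ w p q → dj w (there p) (there q)) (suc-injective len))))

fv-fresh-copy : ∀ {Y} N → WF N → Unique Y → length Y ≡ length (fv N) → Disjoint Y (vars N) →
                fv (renames (fv N) Y N) ≡ Y
fv-fresh-copy {Y} N wN uY len dj =
  trans (fv-renames (fv N) Y N uY dj)
        (map-renVars (fv N) Y (wf-unique wN) (λ z p q → dj z q (fv⊆vars N p)) (sym len))

-- The substitution calculus preserves well-formedness

infix 4 _▷ₑ_
_▷ₑ_ : Term → Term → Set
M ▷ₑ N = WFₑ M → WFₑ N × fv M ≐ fv N

es-var : ∀ {x N} → es (var x) N x ▷ₑ N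
es-var {x} {N} (we-es _ wN _ _) = WF⇒WFₑ wN , ≡⇒≐ (cong (_++ fv N) (remove-here x []))

es-lam : ∀ {y M N x} → y ≢ x → y ∉ fv N → es (lam y M) N x ▷ₑ lam y (es M N x)
es-lam {y} {M} {N} {x} y≢x y∉N (we-es (we-lam wM y∈M) wN x∈ dj) =
  we-lam (we-es wM wN (proj₁ (∈-remove⁻ (fv M) x∈)) dj′) (∈-++⁺ˡ (∈-remove⁺ (fv M) y∈M y≢x)) ,
  ≡⇒≐ fv≡
  where
  dj′ : Disjoint (remove x (fv M)) (fv N)
  dj′ z z∈ z∈N with z ≟ y
  ... | yes refl = y∉N z∈N
  ... | no z≢y = let (z∈M , z≢x) = ∈-remove⁻ (fv M) z∈ in dj z (∈-remove₂⁺ (fv M) z∈M z≢y z≢x) z∈N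
  fv≡ : remove x (remove y (fv M)) ++ fv N ≡ remove y (remove x (fv M) ++ fv N)
  fv≡ = begin
    remove x (remove y (fv M)) ++ fv N             ≡⟨ cong₂ _++_ (remove-comm y x (fv M)) (remove-∉ (fv N) y∉N) ⟨
    remove y (remove x (fv M)) ++ remove y (fv N)  ≡⟨ remove-++ y (remove x (fv M)) (fv N) ⟨
    remove y (remove x (fv M) ++ fv N)             ∎
    where open ≡-Reasoning

es-appL : ∀ {M P N x} → x ∈ fv M → es (app M P) N x ▷ₑ app (es M N x) P
es-appL {M} {P} {N} {x} x∈M w@(we-es (we-app wM wP dMP) wN _ _) =
  we-app (we-es wM wN x∈M (Unique-++⇒Disjoint _ (Unique-++⁻ˡ _ u))) wP (Unique-++⇒Disjoint _ u) ,
  ↭⇒≐ perm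
  where
  perm : fv (es (app M P) N x) ↭ fv (app (es M N x) P)
  perm = begin
    remove x (fv M ++ fv P) ++ fv N           ≡⟨ cong (_++ fv N) (remove-++ x (fv M) (fv P)) ⟩
    (remove x (fv M) ++ remove x (fv P)) ++ fv N ≡⟨ cong (λ L → (remove x (fv M) ++ L) ++ fv N)
                                                      (remove-∉ (fv P) (dMP x x∈M)) ⟩
    (remove x (fv M) ++ fv P) ++ fv N         ↭⟨ ↭-swap-tail (remove x (fv M)) (fv P) (fv N) ⟩
    (remove x (fv M) ++ fv N) ++ fv P         ∎
    where open PermutationReasoning
  u = Unique-resp-↭ perm (fv-unique w)

es-appR : ∀ {M P N x} → x ∈ fv P → es (app M P) N x ▷ₑ app M (es P N x)
es-appR {M} {P} {N} {x} x∈P w@(we-es (we-app wM wP dMP) wN _ _) =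
  we-app wM (we-es wP wN x∈P (Unique-++⇒Disjoint _ (Unique-++⁻ʳ (fv M) u))) (Unique-++⇒Disjoint _ u) ,
  ≡⇒≐ fv≡
  where
  fv≡ : fv (es (app M P) N x) ≡ fv (app M (es P N x))
  fv≡ = begin
    remove x (fv M ++ fv P) ++ fv N              ≡⟨ cong (_++ fv N) (remove-++ x (fv M) (fv P)) ⟩
    (remove x (fv M) ++ remove x (fv P)) ++ fv N ≡⟨ cong (λ L → (L ++ remove x (fv P)) ++ fv N)
                                                      (remove-∉ (fv M) (λ x∈M → dMP x x∈M x∈P)) ⟩
    (fv M ++ remove x (fv P)) ++ fv N            ≡⟨ List-++-assoc (fv M) (remove x (fv P)) (fv N) ⟩
    fv M ++ (remove x (fv P) ++ fv N)            ∎
    where open ≡-Reasoning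
  u = subst Unique fv≡ (fv-unique w)

es-era : ∀ {y M N x} → y ≢ x → es (era y M) N x ▷ₑ era y (es M N x)
es-era {y} {M} {N} {x} y≢x w@(we-es (we-era wM _) wN x∈ _) =
  we-era (we-es wM wN (∈-∷-≢ x∈ (≢-sym y≢x)) (Unique-++⇒Disjoint _ (proj₂ (Unique-∷⁻ u)))) (proj₁ (Unique-∷⁻ u)) ,
  ≡⇒≐ fv≡
  where
  fv≡ : fv (es (era y M) N x) ≡ fv (era y (es M N x))
  fv≡ = cong (_++ fv N) (remove-there (fv M) (≢-sym y≢x))
  u = subst Unique fv≡ (fv-unique w)

fv-eras : ∀ L M → fv (eras L M) ≡ L ++ fv M
fv-eras [] M = refl
fv-eras (x ∷ L) M = cong (x ∷_) (fv-eras L M)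

eras-WFₑ : ∀ L M → Unique (L ++ fv M) → WFₑ M → WFₑ (eras L M)
eras-WFₑ [] M _ w = w
eras-WFₑ (y ∷ L) M (y∉ ∷ u) w =
  we-era (eras-WFₑ L M u w) (λ p → All.lookup y∉ (subst (y ∈_) (fv-eras L M) p) refl)

es-eraX : ∀ {M N x} → es (era x M) N x ▷ₑ eras (fv N) M
es-eraX {M} {N} {x} w@(we-es (we-era wM x∉M) wN _ _) =
  eras-WFₑ (fv N) M (Unique-resp-↭ perm (fv-unique w)) wM ,
  ↭⇒≐ (↭-trans perm (↭-reflexive (sym (fv-eras (fv N) M))))
  where
  perm : fv (es (era x M) N x) ↭ fv N ++ fv M
  perm = begin
    remove x (x ∷ fv M) ++ fv N ≡⟨ cong (_++ fv N) (trans (remove-here x (fv M)) (remove-∉ (fv M) x∉M)) ⟩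
    fv M ++ fv N                ↭⟨ ++-comm (fv M) (fv N) ⟩
    fv N ++ fv M                ∎
    where open PermutationReasoning

es-dup : ∀ {y y1 y2 M N x} → y ≢ x → y1 ≢ x → y2 ≢ x → y1 ∉ fv N → y2 ∉ fv N →
         es (dup y y1 y2 M) N x ▷ₑ dup y y1 y2 (es M N x)
es-dup {y} {y1} {y2} {M} {N} {x} y≢x y1≢x y2≢x y1∉N y2∉N w@(we-es (we-dup wM y1∈ y2∈ y1≢y2 _) wN x∈ dj) =
  we-dup (we-es wM wN x∈M dj′) (∈-++⁺ˡ (∈-remove⁺ (fv M) y1∈ y1≢x)) (∈-++⁺ˡ (∈-remove⁺ (fv M) y2∈ y2≢x))
         y1≢y2 (proj₁ (Unique-∷⁻ (subst Unique fv≡ (fv-unique w)))) ,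
  ≡⇒≐ fv≡
  where
  x∈M : x ∈ fv M
  x∈M = proj₁ (∈-remove₂⁻ (fv M) (∈-∷-≢ x∈ (≢-sym y≢x)))
  dj′ : Disjoint (remove x (fv M)) (fv N)
  dj′ z z∈ z∈N =
    let (z∈M , z≢x) = ∈-remove⁻ (fv M) z∈ in
    dj z (∈-remove⁺ _ (there (∈-remove₂⁺ (fv M) z∈M (λ { refl → y1∉N z∈N }) (λ { refl → y2∉N z∈N }))) z≢x) z∈N
  fv≡ : fv (es (dup y y1 y2 M) N x) ≡ fv (dup y y1 y2 (es M N x))
  fv≡ = begin
    remove x (y ∷ remove y2 (remove y1 (fv M))) ++ fv N
      ≡⟨ cong (_++ fv N) (remove-there (remove y2 (remove y1 (fv M))) (≢-sym y≢x)) ⟩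
    y ∷ (remove x (remove y2 (remove y1 (fv M))) ++ fv N)
      ≡⟨ cong (λ L → y ∷ (L ++ fv N)) (remove-remove₂ x y1 y2 (fv M)) ⟩
    y ∷ (remove y2 (remove y1 (remove x (fv M))) ++ fv N)
      ≡⟨ cong (λ L → y ∷ (remove y2 (remove y1 (remove x (fv M))) ++ L)) (remove₂-∉ (fv N) y1∉N y2∉N) ⟨
    y ∷ (remove y2 (remove y1 (remove x (fv M))) ++ remove y2 (remove y1 (fv N)))
      ≡⟨ cong (y ∷_) (remove₂-++ y1 y2 (remove x (fv M)) (fv N)) ⟨
    y ∷ remove y2 (remove y1 (remove x (fv M) ++ fv N))
      ∎
    where open ≡-Reasoning

fv-dups⁻ : ∀ {z} X Y Z K → length X ≡ length Y → length X ≡ length Z →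
           z ∈ fv (dups X Y Z K) → z ∈ X ⊎ (z ∈ fv K × z ∉ Y × z ∉ Z)
fv-dups⁻ [] [] [] K _ _ p = inj₂ (p , (λ ()) , (λ ()))
fv-dups⁻ (x ∷ X) (y ∷ Y) (w ∷ Z) K _ _ (here e) = inj₁ (here e)
fv-dups⁻ (x ∷ X) (y ∷ Y) (w ∷ Z) K lenY lenZ (there p)
  with ∈-remove₂⁻ (fv (dups X Y Z K)) p
... | p′ , z≢y , z≢w with fv-dups⁻ X Y Z K (suc-injective lenY) (suc-injective lenZ) p′
...   | inj₁ q = inj₁ (there q)
...   | inj₂ (q , z∉Y , z∉Z) =
  inj₂ (q , (λ { (here e) → z≢y e ; (there r) → z∉Y r }) , (λ { (here e) → z≢w e ; (there r) → z∉Z r }))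

fv-dups⁺ᴷ : ∀ {z} X Y Z K → z ∈ fv K → z ∉ Y → z ∉ Z → z ∈ fv (dups X Y Z K)
fv-dups⁺ᴷ (x ∷ X) (y ∷ Y) (w ∷ Z) K p z∉Y z∉Z =
  there (∈-remove₂⁺ (fv (dups X Y Z K)) (fv-dups⁺ᴷ X Y Z K p (z∉Y ∘ there) (z∉Z ∘ there))
                    (z∉Y ∘ here) (z∉Z ∘ here))
fv-dups⁺ᴷ [] Y Z K p _ _ = p
fv-dups⁺ᴷ (x ∷ X) [] Z K p _ _ = p
fv-dups⁺ᴷ (x ∷ X) (y ∷ Y) [] K p _ _ = p

fv-dups⁺ˣ : ∀ {z} X Y Z K → length X ≡ length Y → length X ≡ length Z → Disjoint X Y → Disjoint X Z →
            z ∈ X → z ∈ fv (dups X Y Z K)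
fv-dups⁺ˣ (x ∷ X) (y ∷ Y) (w ∷ Z) K _ _ _ _ (here e) = here e
fv-dups⁺ˣ {z} (x ∷ X) (y ∷ Y) (w ∷ Z) K lenY lenZ X#Y X#Z (there p) =
  there (∈-remove₂⁺ (fv (dups X Y Z K))
           (fv-dups⁺ˣ X Y Z K (suc-injective lenY) (suc-injective lenZ)
              (λ v a b → X#Y v (there a) (there b)) (λ v a b → X#Z v (there a) (there b)) p)
           (X#Y z (there p) ∘ here) (X#Z z (there p) ∘ here))

dups-WFₑ : ∀ X Y Z K → length X ≡ length Y → length X ≡ length Z →
           Unique X → Unique Y → Unique Z → Disjoint Y Z → Disjoint X (fv K) →
           Y ⊆ fv K → Z ⊆ fv K → WFₑ K → WFₑ (dups X Y Z K)
dups-WFₑ [] [] [] K _ _ _ _ _ _ _ _ _ wK = wK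
dups-WFₑ (x ∷ X) (y ∷ Y) (w ∷ Z) K lenY lenZ (x∉X ∷ uX) (y∉Y ∷ uY) (w∉Z ∷ uZ) Y#Z X#K Y⊆K Z⊆K wK =
  we-dup (dups-WFₑ X Y Z K lenY′ lenZ′ uX uY uZ (λ v a b → Y#Z v (there a) (there b))
                   (λ v a → X#K v (there a)) (Y⊆K ∘ there) (Z⊆K ∘ there) wK)
         (fv-dups⁺ᴷ X Y Z K (Y⊆K (here refl)) (λ p → All.lookup y∉Y p refl) (Y#Z y (here refl) ∘ there))
         (fv-dups⁺ᴷ X Y Z K (Z⊆K (here refl)) (λ p → Y#Z w (there p) (here refl)) (λ p → All.lookup w∉Z p refl))
         (Y#Z y (here refl) ∘ here)
         x∉
  where
  lenY′ = suc-injective lenY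
  lenZ′ = suc-injective lenZ
  x∉ : x ∉ remove w (remove y (fv (dups X Y Z K)))
  x∉ p with fv-dups⁻ X Y Z K lenY′ lenZ′ (proj₁ (∈-remove₂⁻ _ p))
  ... | inj₁ x∈X = All.lookup x∉X x∈X refl
  ... | inj₂ (x∈K , _) = X#K x (here refl) x∈K

-- The duplication rule x<^{x1}_{x2}M [N/x] ⇝ Fv[N] <^Y_Z M[N1/x1][N2/x2], where N1, N2 are
-- copies of N whose free variables Y, Z are fresh.
module DuplicationRule
  {x x1 x2 : Var} {M N N1 N2 : Term}
  (wM : WFₑ M) (x1∈ : x1 ∈ fv M) (x2∈ : x2 ∈ fv M) (x1≢x2 : x1 ≢ x2) (wN : WF N)
  (x∉ : x ∉ remove x2 (remove x1 (fv M))) (uT : Unique (fv (es (dup x x1 x2 M) N x)))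
  (wN1 : WF N1) (wN2 : WF N2) (uY : Unique (fv N1)) (uZ : Unique (fv N2))
  (lenY : length (fv N1) ≡ length (fv N)) (lenZ : length (fv N2) ≡ length (fv N))
  (Y#T : Disjoint (fv N1) (vars (es (dup x x1 x2 M) N x)))
  (Z#T : Disjoint (fv N2) (vars (es (dup x x1 x2 M) N x)))
  (Y#Z : Disjoint (fv N1) (fv N2))
  where

  T = es (dup x x1 x2 M) N x
  K = es (es M N1 x1) N2 x2
  X = fv N
  Y = fv N1
  Z = fv N2
  R = dups X Y Z K
  R₀ = remove x2 (remove x1 (fv M))

  module Fresh (V : List Var) (V#T : Disjoint V (vars T)) where
    #M : ∀ {z} → z ∈ V → z ∉ fv M
    #M {z} p = V#T z p ∘ there ∘ there ∘ there ∘ there ∘ ∈-++⁺ˡ ∘ fv⊆vars M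
    #N : ∀ {z} → z ∈ V → z ∉ fv N
    #N {z} p = V#T z p ∘ there ∘ there ∘ there ∘ there ∘ ∈-++⁺ʳ (vars M) ∘ fv⊆vars N
    x2∉ : x2 ∉ V
    x2∉ p = V#T x2 p (there (there (there (here refl))))

  open Fresh Y Y#T renaming (#M to Y#M; #N to Y#N; x2∉ to x2∉Y)
  open Fresh Z Z#T renaming (#M to Z#M; #N to Z#N)

  fvT≡ : fv T ≡ R₀ ++ X
  fvT≡ = cong (_++ X) (trans (remove-here x R₀) (remove-∉ R₀ x∉))

  fvK≡ : fv K ≡ (R₀ ++ Y) ++ Z
  fvK≡ = cong (_++ Z) (trans (remove-++ x2 (remove x1 (fv M)) Y) (cong (R₀ ++_) (remove-∉ Y x2∉Y)))

  R₀#X : Disjoint R₀ X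
  R₀#X = Unique-++⇒Disjoint R₀ (subst Unique fvT≡ uT)

  K-WFₑ : WFₑ K
  K-WFₑ = we-es (we-es wM wN1 x1∈ (λ z p q → Y#M q (proj₁ (∈-remove⁻ (fv M) p))))
                wN2 (∈-++⁺ˡ (∈-remove⁺ (fv M) x2∈ (≢-sym x1≢x2))) inner#Z
    where
    inner#Z : Disjoint (remove x2 (remove x1 (fv M) ++ Y)) Z
    inner#Z z p q with ∈-++⁻ (remove x1 (fv M)) (proj₁ (∈-remove⁻ _ p))
    ... | inj₁ r = Z#M q (proj₁ (∈-remove⁻ (fv M) r))
    ... | inj₂ r = Y#Z z r q

  X#K : Disjoint X (fv K)
  X#K z p q with ∈-++⁻ (R₀ ++ Y) (subst (z ∈_) fvK≡ q)
  ... | inj₂ r = Z#N r p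
  ... | inj₁ r with ∈-++⁻ R₀ r
  ...   | inj₁ s = R₀#X z s p
  ...   | inj₂ s = Y#N s p

  R-WFₑ : WFₑ R
  R-WFₑ = dups-WFₑ X Y Z K (sym lenY) (sym lenZ) (wf-unique wN) uY uZ Y#Z X#K
                   (λ q → subst (_ ∈_) (sym fvK≡) (∈-++⁺ˡ (∈-++⁺ʳ R₀ q)))
                   (λ q → subst (_ ∈_) (sym fvK≡) (∈-++⁺ʳ (R₀ ++ Y) q)) K-WFₑ

  T⊆R : fv T ⊆ fv R
  T⊆R {z} p with ∈-++⁻ R₀ (subst (z ∈_) fvT≡ p)
  ... | inj₂ q = fv-dups⁺ˣ X Y Z K (sym lenY) (sym lenZ) (λ v a b → Y#N b a) (λ v a b → Z#N b a) q
  ... | inj₁ q = let z∈M = proj₁ (∈-remove₂⁻ (fv M) q) in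
    fv-dups⁺ᴷ X Y Z K (subst (z ∈_) (sym fvK≡) (∈-++⁺ˡ (∈-++⁺ˡ q))) (λ a → Y#M a z∈M) (λ a → Z#M a z∈M)

  R⊆T : fv R ⊆ fv T
  R⊆T {z} p = subst (z ∈_) (sym fvT≡) (in-R₀++X (fv-dups⁻ X Y Z K (sym lenY) (sym lenZ) p))
    where
    in-R₀++X : z ∈ X ⊎ (z ∈ fv K × z ∉ Y × z ∉ Z) → z ∈ R₀ ++ X
    in-R₀++X (inj₁ q) = ∈-++⁺ʳ R₀ q
    in-R₀++X (inj₂ (q , z∉Y , z∉Z)) with ∈-++⁻ (R₀ ++ Y) (subst (z ∈_) fvK≡ q)
    ... | inj₂ r = ⊥-elim (z∉Z r)
    ... | inj₁ r with ∈-++⁻ R₀ r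
    ...   | inj₁ s = ∈-++⁺ˡ s
    ...   | inj₂ s = ⊥-elim (z∉Y s)

es-dupX : ∀ {x x1 x2 M N} (Y Z : List Var) →
          FreshFor Y N (es (dup x x1 x2 M) N x) → FreshFor Z N (es (dup x x1 x2 M) N x) → Disjoint Y Z →
          es (dup x x1 x2 M) N x ▷ₑ
            dups (fv N) (fv (renames (fv N) Y N)) (fv (renames (fv N) Z N))
                 (es (es M (renames (fv N) Y N) x1) (renames (fv N) Z N) x2)
es-dupX {x} {x1} {x2} {M} {N} Y Z (uY , lenY , Y#T) (uZ , lenZ , Z#T) Y#Z
        w@(we-es (we-dup wM x1∈ x2∈ x1≢x2 x∉) wN _ _) =
  R-WFₑ , T⊆R , R⊆T
  where
  Y#N : Disjoint Y (vars N)
  Y#N z p = Y#T z p ∘ there ∘ there ∘ there ∘ there ∘ ∈-++⁺ʳ (vars M)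
  Z#N : Disjoint Z (vars N)
  Z#N z p = Z#T z p ∘ there ∘ there ∘ there ∘ there ∘ ∈-++⁺ʳ (vars M)
  fvY = fv-fresh-copy N wN uY lenY Y#N
  fvZ = fv-fresh-copy N wN uZ lenZ Z#N
  open DuplicationRule wM x1∈ x2∈ x1≢x2 wN x∉ (fv-unique w)
    (WF-renames (fv N) Y N uY Y#N wN) (WF-renames (fv N) Z N uZ Z#N wN)
    (subst Unique (sym fvY) uY) (subst Unique (sym fvZ) uZ)
    (trans (cong length fvY) lenY) (trans (cong length fvZ) lenZ)
    (subst (λ L → Disjoint L _) (sym fvY) Y#T) (subst (λ L → Disjoint L _) (sym fvZ) Z#T)
    (subst₂ Disjoint (sym fvY) (sym fvZ) Y#Z)

-- A term of Λ® contains no explicit substitution, hence no redex of the calculus.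
WF-normal : ∀ {N N′} → WF N → N ⇝ N′ → ⊥
WF-normal () (e-base s-var)
WF-normal () (e-base (s-lam _ _))
WF-normal () (e-base (s-appL _))
WF-normal () (e-base (s-appR _))
WF-normal () (e-base (s-era _))
WF-normal () (e-base s-eraX)
WF-normal () (e-base (s-dup _ _ _ _ _))
WF-normal () (e-base (s-dupX _ _ _ _ _))
WF-normal (wf-lam w _) (e-lam r) = WF-normal w r
WF-normal (wf-app w _ _) (e-appL r) = WF-normal w r
WF-normal (wf-app _ w _) (e-appR r) = WF-normal w r
WF-normal (wf-era w _) (e-era r) = WF-normal w r
WF-normal (wf-dup w _ _ _ _) (e-dup r) = WF-normal w r

⇝₀-pres : ∀ {M N} → M ⇝₀ N → M ▷ₑ N
⇝₀-pres s-var = es-var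
⇝₀-pres (s-lam y≢x y∉N) = es-lam y≢x y∉N
⇝₀-pres (s-appL x∈M) = es-appL x∈M
⇝₀-pres (s-appR x∈P) = es-appR x∈P
⇝₀-pres (s-era y≢x) = es-era y≢x
⇝₀-pres s-eraX = es-eraX
⇝₀-pres (s-dup y≢x y1≢x y2≢x y1∉N y2∉N) = es-dup y≢x y1≢x y2≢x y1∉N y2∉N
⇝₀-pres (s-dupX Y Z freshY freshZ Y#Z) = es-dupX Y Z freshY freshZ Y#Z

⇝-pres : ∀ {M N} → M ⇝ N → M ▷ₑ N
⇝-pres (e-base r) w = ⇝₀-pres r w
⇝-pres (e-lam {x} r) (we-lam w x∈) =
  let (w′ , s , t) = ⇝-pres r w in we-lam w′ (s x∈) , ≐-remove (s , t)
⇝-pres (e-appL r) (we-app wM wN dj) =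
  let (w′ , s , t) = ⇝-pres r wM in we-app w′ wN (λ z p → dj z (t p)) , ≐-++ (s , t) (id , id)
⇝-pres (e-appR r) (we-app wM wN dj) =
  let (w′ , s , t) = ⇝-pres r wN in we-app wM w′ (λ z p q → dj z p (t q)) , ≐-++ (id , id) (s , t)
⇝-pres (e-era r) (we-era w x∉) =
  let (w′ , s , t) = ⇝-pres r w in we-era w′ (x∉ ∘ t) , ≐-∷ (s , t)
⇝-pres (e-dup {x} {x1} {x2} r) (we-dup w x1∈ x2∈ x1≢x2 x∉) =
  let (w′ , s , t) = ⇝-pres r w ; (s₂ , t₂) = ≐-remove₂ {x1} {x2} (s , t) in
  we-dup w′ (s x1∈) (s x2∈) x1≢x2 (x∉ ∘ t₂) , ≐-∷ (s₂ , t₂)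
⇝-pres (e-esL {x = x} r) (we-es w wN x∈ dj) =
  let (w′ , s , t) = ⇝-pres r w ; (s₁ , t₁) = ≐-remove {x} (s , t) in
  we-es w′ wN (s x∈) (λ z p → dj z (t₁ p)) , ≐-++ (s₁ , t₁) (id , id)
⇝-pres (e-esR r) (we-es _ wN _ _) = ⊥-elim (WF-normal wN r)

⇝*-pres : ∀ {M N} → M ⇝* N → M ▷ₑ N
⇝*-pres ε w = w , id , id
⇝*-pres (r ◅ rs) w =
  let (w₁ , eq₁) = ⇝-pres r w ; (w₂ , eq₂) = ⇝*-pres rs w₁ in w₂ , ≐-trans eq₁ eq₂

Subst-pres : ∀ {M N x P} → Subst M N x P → WF P × remove x (fv M) ++ fv N ≐ fv P
Subst-pres (wM , wN , x∈ , dj , steps , pure) =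
  let (w , eq) = ⇝*-pres steps (we-es (WF⇒WFₑ wM) wN x∈ dj) in WFₑ⇒WF w pure , eq

-- Structural equivalence preserves well-formedness

infix 4 _▷_
_▷_ : Term → Term → Set
M ▷ N = WF M → WF N × fv M ≐ fv N

▷-refl : ∀ {M} → M ▷ M
▷-refl w = w , id , id

▷-trans : ∀ {M N P} → M ▷ N → N ▷ P → M ▷ P
▷-trans r r′ w = let (w₁ , eq₁) = r w ; (w₂ , eq₂) = r′ w₁ in w₂ , ≐-trans eq₁ eq₂

▷-lam : ∀ {x M M′} → M ▷ M′ → lam x M ▷ lam x M′
▷-lam r (wf-lam w x∈) = let (w′ , s , t) = r w in wf-lam w′ (s x∈) , ≐-remove (s , t)

▷-app : ∀ {M M′ N N′} → M ▷ M′ → N ▷ N′ → app M N ▷ app M′ N′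
▷-app r r′ (wf-app wM wN dj) =
  let (wM′ , s , t) = r wM ; (wN′ , s′ , t′) = r′ wN in
  wf-app wM′ wN′ (λ z p q → dj z (t p) (t′ q)) , ≐-++ (s , t) (s′ , t′)

▷-era : ∀ {x M M′} → M ▷ M′ → era x M ▷ era x M′
▷-era r (wf-era w x∉) = let (w′ , s , t) = r w in wf-era w′ (x∉ ∘ t) , ≐-∷ (s , t)

▷-dup : ∀ {x x1 x2 M M′} → M ▷ M′ → dup x x1 x2 M ▷ dup x x1 x2 M′
▷-dup {x1 = x1} {x2} r (wf-dup w x1∈ x2∈ x1≢x2 x∉) =
  let (w′ , s , t) = r w ; (s₂ , t₂) = ≐-remove₂ {x1} {x2} (s , t) in
  wf-dup w′ (s x1∈) (s x2∈) x1≢x2 (x∉ ∘ t₂) , ≐-∷ (s₂ , t₂)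

era-swap : ∀ {x y M} → era x (era y M) ▷ era y (era x M)
era-swap {x} {y} w@(wf-era (wf-era wM _) _) =
  wf-era (wf-era wM (proj₁ (Unique-∷⁻ (proj₂ (Unique-∷⁻ u))))) (proj₁ (Unique-∷⁻ u)) , ↭⇒≐ perm
  where
  perm = ↭-swap x y ↭-refl
  u = Unique-resp-↭ perm (wf-unique w)

dup-swap : ∀ {x x1 x2 M} → dup x x1 x2 M ▷ dup x x2 x1 M
dup-swap {x} {x1} {x2} {M} (wf-dup w x1∈ x2∈ x1≢x2 x∉) =
  wf-dup w x2∈ x1∈ (≢-sym x1≢x2) (x∉ ∘ subst (x ∈_) (sym fv≡)) , ≡⇒≐ (cong (x ∷_) fv≡)
  where
  fv≡ : remove x2 (remove x1 (fv M)) ≡ remove x1 (remove x2 (fv M))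
  fv≡ = remove-comm x2 x1 (fv M)

dup-assoc : ∀ {x y z u v M} → z ≢ v → y ≢ u → u ≢ z →
            dup x y z (dup y u v M) ▷ dup x y u (dup y z v M)
dup-assoc {x} {y} {z} {u} {v} {M} z≢v y≢u u≢z (wf-dup (wf-dup wM u∈ v∈ u≢v y∉) y∈ z∈ y≢z x∉) =
  wf-dup (wf-dup wM z∈M v∈ z≢v y∉′) (here refl) (there (∈-remove₂⁺ (fv M) u∈ u≢z u≢v)) y≢u
         (x∉ ∘ subst (x ∈_) (sym fv≡)) ,
  ≡⇒≐ (cong (x ∷_) fv≡)
  where
  z∈M : z ∈ fv M
  z∈M = proj₁ (∈-remove₂⁻ (fv M) (∈-∷-≢ z∈ (≢-sym y≢z)))
  y∉′ : y ∉ remove v (remove z (fv M))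
  y∉′ p = let (y∈M , _ , y≢v) = ∈-remove₂⁻ (fv M) p in y∉ (∈-remove₂⁺ (fv M) y∈M y≢u y≢v)
  fv≡ : remove z (remove y (y ∷ remove v (remove u (fv M)))) ≡ remove u (remove y (y ∷ remove v (remove z (fv M))))
  fv≡ = begin
    remove z (remove y (y ∷ remove v (remove u (fv M)))) ≡⟨ cong (remove z) (remove-here y (remove v (remove u (fv M)))) ⟩
    remove z (remove y (remove v (remove u (fv M))))     ≡⟨ cong (remove z ∘ remove y) (remove-comm v u (fv M)) ⟩
    remove z (remove y (remove u (remove v (fv M))))     ≡⟨ cong (remove z) (remove-comm y u (remove v (fv M))) ⟩
    remove z (remove u (remove y (remove v (fv M))))     ≡⟨ remove-comm z u (remove y (remove v (fv M))) ⟩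
    remove u (remove z (remove y (remove v (fv M))))     ≡⟨ cong (remove u) (remove-remove₂ z v y (fv M)) ⟩
    remove u (remove y (remove v (remove z (fv M))))     ≡⟨ cong (remove u) (remove-here y (remove v (remove z (fv M)))) ⟨
    remove u (remove y (y ∷ remove v (remove z (fv M)))) ∎
    where open ≡-Reasoning

dup-comm : ∀ {x x1 x2 y y1 y2 M} → x ≢ y1 → x ≢ y2 → y ≢ x1 → y ≢ x2 →
           dup x x1 x2 (dup y y1 y2 M) ▷ dup y y1 y2 (dup x x1 x2 M)
dup-comm {x} {x1} {x2} {y} {y1} {y2} {M} x≢y1 x≢y2 y≢x1 y≢x2
         w@(wf-dup (wf-dup wM y1∈ y2∈ y1≢y2 _) x1∈ x2∈ x1≢x2 x∉) =
  wf-dup (wf-dup wM x1∈M x2∈M x1≢x2 x∉′)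
         (there (∈-remove₂⁺ (fv M) y1∈ (≢-sym x1≢y1) (≢-sym x2≢y1)))
         (there (∈-remove₂⁺ (fv M) y2∈ (≢-sym x1≢y2) (≢-sym x2≢y2)))
         y1≢y2 (proj₁ (Unique-∷⁻ (Unique-resp-↭ perm (wf-unique w)))) ,
  ↭⇒≐ perm
  where
  x1∈M = proj₁ (∈-remove₂⁻ (fv M) (∈-∷-≢ x1∈ (≢-sym y≢x1)))
  x2∈M = proj₁ (∈-remove₂⁻ (fv M) (∈-∷-≢ x2∈ (≢-sym y≢x2)))
  x1≢y1 = proj₁ (proj₂ (∈-remove₂⁻ (fv M) (∈-∷-≢ x1∈ (≢-sym y≢x1))))
  x1≢y2 = proj₂ (proj₂ (∈-remove₂⁻ (fv M) (∈-∷-≢ x1∈ (≢-sym y≢x1))))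
  x2≢y1 = proj₁ (proj₂ (∈-remove₂⁻ (fv M) (∈-∷-≢ x2∈ (≢-sym y≢x2))))
  x2≢y2 = proj₂ (proj₂ (∈-remove₂⁻ (fv M) (∈-∷-≢ x2∈ (≢-sym y≢x2))))
  x∉′ : x ∉ remove x2 (remove x1 (fv M))
  x∉′ p = let (x∈M , x≢x1 , x≢x2) = ∈-remove₂⁻ (fv M) p in
    x∉ (∈-remove₂⁺ _ (there (∈-remove₂⁺ (fv M) x∈M x≢y1 x≢y2)) x≢x1 x≢x2)
  perm : fv (dup x x1 x2 (dup y y1 y2 M)) ↭ fv (dup y y1 y2 (dup x x1 x2 M))
  perm = begin
    x ∷ remove x2 (remove x1 (y ∷ remove y2 (remove y1 (fv M))))
      ≡⟨ cong (x ∷_) (remove₂-there (remove y2 (remove y1 (fv M))) (≢-sym y≢x1) (≢-sym y≢x2)) ⟩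
    x ∷ y ∷ remove x2 (remove x1 (remove y2 (remove y1 (fv M))))
      ↭⟨ ↭-swap x y ↭-refl ⟩
    y ∷ x ∷ remove x2 (remove x1 (remove y2 (remove y1 (fv M))))
      ≡⟨ cong (λ L → y ∷ x ∷ L) (remove₂-comm x1 x2 y1 y2 (fv M)) ⟩
    y ∷ x ∷ remove y2 (remove y1 (remove x2 (remove x1 (fv M))))
      ≡⟨ cong (y ∷_) (remove₂-there (remove x2 (remove x1 (fv M))) (≢-sym x≢y1) (≢-sym x≢y2)) ⟨
    y ∷ remove y2 (remove y1 (x ∷ remove x2 (remove x1 (fv M))))
      ∎
    where open PermutationReasoning

α-lam-pres : ∀ {x y M} → y ∉ vars (lam x M) → lam x M ▷ lam y (ren x y M) × lam y (ren x y M) ▷ lam x M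
α-lam-pres {x} {y} {M} y∉ =
  (λ { (wf-lam w x∈) → wf-lam (WF-ren⁺ M y∉M w) (y∈ren x∈) , ≡⇒≐ fv≡ }) ,
  (λ { (wf-lam w y∈) → wf-lam (WF-ren⁻ M y∉M w) (fresh∈map⇒∈ (fv M) y∉FM (subst (y ∈_) (fv-ren M y∉M) y∈)) ,
                       ≡⇒≐ (sym fv≡) })
  where
  y∉M = y∉ ∘ there
  y∉FM = ∉vars⇒∉fv M y∉M
  y∈ren : x ∈ fv M → y ∈ fv (ren x y M)
  y∈ren x∈ = subst (y ∈_) (sym (fv-ren M y∉M)) (subst (_∈ map (renVar x y) (fv M)) (renVar-hit x y) (∈-map⁺ _ x∈))
  fv≡ : remove x (fv M) ≡ remove y (fv (ren x y M))
  fv≡ = sym (trans (cong (remove y) (fv-ren M y∉M)) (remove-map-renVar-fresh (fv M) y∉FM))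

α-dup-pres : ∀ {x x1 x2 y M} → y ∉ vars (dup x x1 x2 M) →
        dup x x1 x2 M ▷ dup x y x2 (ren x1 y M) × dup x y x2 (ren x1 y M) ▷ dup x x1 x2 M
α-dup-pres {x} {x1} {x2} {y} {M} y∉ = forward , backward
  where
  y∉M = y∉ ∘ there ∘ there ∘ there
  y∉FM = ∉vars⇒∉fv M y∉M
  y≢x2 : y ≢ x2
  y≢x2 = y∉ ∘ there ∘ there ∘ here
  fv≡ : remove x2 (remove x1 (fv M)) ≡ remove x2 (remove y (fv (ren x1 y M)))
  fv≡ = sym (cong (remove x2) (trans (cong (remove y) (fv-ren M y∉M)) (remove-map-renVar-fresh (fv M) y∉FM)))
  forward : dup x x1 x2 M ▷ dup x y x2 (ren x1 y M)
  forward (wf-dup w x1∈ x2∈ x1≢x2 x∉) =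
    wf-dup (WF-ren⁺ M y∉M w)
           (subst (y ∈_) (sym (fv-ren M y∉M)) (subst (_∈ map (renVar x1 y) (fv M)) (renVar-hit x1 y) (∈-map⁺ _ x1∈)))
           (subst (x2 ∈_) (sym (fv-ren M y∉M)) (∈-map-renVar⁺ (fv M) x2∈ (≢-sym x1≢x2)))
           y≢x2 (x∉ ∘ subst (x ∈_) (sym fv≡)) ,
    ≡⇒≐ (cong (x ∷_) fv≡)
  backward : dup x y x2 (ren x1 y M) ▷ dup x x1 x2 M
  backward (wf-dup w y∈ x2∈ _ x∉) =
    wf-dup (WF-ren⁻ M y∉M w) (fresh∈map⇒∈ (fv M) y∉FM (subst (y ∈_) (fv-ren M y∉M) y∈))
           (proj₁ x2∈M) (≢-sym (proj₂ x2∈M)) (x∉ ∘ subst (x ∈_) fv≡) ,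
    ≡⇒≐ (cong (x ∷_) (sym fv≡))
    where x2∈M = ∈-map-renVar⁻ (fv M) (subst (x2 ∈_) (fv-ren M y∉M) x2∈) (≢-sym y≢x2)

≈-pres : ∀ {M N} → M ≈ N → M ▷ N × N ▷ M
≈-pres ≈-refl = ▷-refl , ▷-refl
≈-pres (≈-sym e) = let (r , r′) = ≈-pres e in r′ , r
≈-pres (≈-trans e f) = let (r₁ , r₁′) = ≈-pres e ; (r₂ , r₂′) = ≈-pres f in ▷-trans r₁ r₂ , ▷-trans r₂′ r₁′
≈-pres (≈-lam e) = let (r , r′) = ≈-pres e in ▷-lam r , ▷-lam r′
≈-pres (≈-app e f) = let (r₁ , r₁′) = ≈-pres e ; (r₂ , r₂′) = ≈-pres f in ▷-app r₁ r₂ , ▷-app r₁′ r₂′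
≈-pres (≈-era e) = let (r , r′) = ≈-pres e in ▷-era r , ▷-era r′
≈-pres (≈-dup e) = let (r , r′) = ≈-pres e in ▷-dup r , ▷-dup r′
≈-pres (α-lam y∉) = α-lam-pres y∉
≈-pres (α-dup y∉) = α-dup-pres y∉
≈-pres ax-era = era-swap , era-swap
≈-pres ax-swap = dup-swap , dup-swap
≈-pres (ax-assoc ((_ ∷ _ ∷ _ ∷ _ ∷ []) ∷ (y≢z ∷ y≢u ∷ _ ∷ []) ∷ (z≢u ∷ z≢v ∷ []) ∷ (u≢v ∷ []) ∷ [] ∷ [])) =
  dup-assoc z≢v y≢u (≢-sym z≢u) , dup-assoc u≢v y≢z z≢u
≈-pres (ax-comm x≢y1 x≢y2 y≢x1 y≢x2) = dup-comm x≢y1 x≢y2 y≢x1 y≢x2 , dup-comm y≢x1 y≢x2 x≢y1 x≢y2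

-- Reduction preserves well-formedness

-- The base rules.  β and garbage collection are reduced to the substitution
-- calculus; the other rules permute the free variable list, and most side
-- conditions of the reduct follow from the duplicate-freeness of that list.
β-pres : ∀ {x M N P} → Subst M N x P → app (lam x M) N ▷ P
β-pres s _ = Subst-pres s

dupLam-pres : ∀ {x x1 x2 y M} → y ≢ x → y ≢ x1 → y ≢ x2 → dup x x1 x2 (lam y M) ▷ lam y (dup x x1 x2 M)
dupLam-pres {x} {x1} {x2} {y} {M} y≢x y≢x1 y≢x2 (wf-dup (wf-lam wM y∈) x1∈ x2∈ x1≢x2 x∉) =
  wf-lam (wf-dup wM (proj₁ (∈-remove⁻ (fv M) x1∈)) (proj₁ (∈-remove⁻ (fv M) x2∈)) x1≢x2 x∉′)
         (there (∈-remove₂⁺ (fv M) y∈ y≢x1 y≢x2)) ,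
  ≡⇒≐ fv≡
  where
  x∉′ : x ∉ remove x2 (remove x1 (fv M))
  x∉′ p = let (x∈M , x≢x1 , x≢x2) = ∈-remove₂⁻ (fv M) p in
    x∉ (∈-remove₂⁺ _ (∈-remove⁺ (fv M) x∈M (≢-sym y≢x)) x≢x1 x≢x2)
  fv≡ : x ∷ remove x2 (remove x1 (remove y (fv M))) ≡ remove y (x ∷ remove x2 (remove x1 (fv M)))
  fv≡ = begin
    x ∷ remove x2 (remove x1 (remove y (fv M))) ≡⟨ cong (x ∷_) (remove-remove₂ y x1 x2 (fv M)) ⟨
    x ∷ remove y (remove x2 (remove x1 (fv M))) ≡⟨ remove-there (remove x2 (remove x1 (fv M))) y≢x ⟨
    remove y (x ∷ remove x2 (remove x1 (fv M))) ∎
    where open ≡-Reasoning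

dupAppL-pres : ∀ {x x1 x2 M N} → x1 ∉ fv N → x2 ∉ fv N → dup x x1 x2 (app M N) ▷ app (dup x x1 x2 M) N
dupAppL-pres {x} {x1} {x2} {M} {N} x1∉N x2∉N w@(wf-dup (wf-app wM wN _) x1∈ x2∈ x1≢x2 _) =
  wf-app (wf-dup wM (∈-++-∉ʳ (fv M) x1∈ x1∉N) (∈-++-∉ʳ (fv M) x2∈ x2∉N) x1≢x2
                 (proj₁ (Unique-∷⁻ (Unique-++⁻ˡ (fv (dup x x1 x2 M)) u))))
         wN (Unique-++⇒Disjoint (fv (dup x x1 x2 M)) u) ,
  ≡⇒≐ fv≡
  where
  fv≡ : fv (dup x x1 x2 (app M N)) ≡ fv (app (dup x x1 x2 M) N)
  fv≡ = cong (x ∷_) (trans (remove₂-++ x1 x2 (fv M) (fv N))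
                           (cong (remove x2 (remove x1 (fv M)) ++_) (remove₂-∉ (fv N) x1∉N x2∉N)))
  u = subst Unique fv≡ (wf-unique w)

dupAppR-pres : ∀ {x x1 x2 M N} → x1 ∉ fv M → x2 ∉ fv M → dup x x1 x2 (app M N) ▷ app M (dup x x1 x2 N)
dupAppR-pres {x} {x1} {x2} {M} {N} x1∉M x2∉M w@(wf-dup (wf-app wM wN _) x1∈ x2∈ x1≢x2 _) =
  wf-app wM (wf-dup wN (∈-++-∉ˡ (fv M) x1∈ x1∉M) (∈-++-∉ˡ (fv M) x2∈ x2∉M) x1≢x2
                    (proj₁ (Unique-∷⁻ (Unique-++⁻ʳ (fv M) u))))
         (Unique-++⇒Disjoint (fv M) u) ,
  ↭⇒≐ perm
  where
  perm : fv (dup x x1 x2 (app M N)) ↭ fv (app M (dup x x1 x2 N))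
  perm = begin
    x ∷ remove x2 (remove x1 (fv M ++ fv N))
      ≡⟨ cong (x ∷_) (trans (remove₂-++ x1 x2 (fv M) (fv N))
                            (cong (_++ remove x2 (remove x1 (fv N))) (remove₂-∉ (fv M) x1∉M x2∉M))) ⟩
    x ∷ fv M ++ remove x2 (remove x1 (fv N))
      ↭⟨ shift x (fv M) (remove x2 (remove x1 (fv N))) ⟨
    fv M ++ x ∷ remove x2 (remove x1 (fv N))
      ∎
    where open PermutationReasoning
  u = Unique-resp-↭ perm (wf-unique w)

lamEra-pres : ∀ {x y M} → x ≢ y → lam x (era y M) ▷ era y (lam x M)
lamEra-pres {x} {y} {M} x≢y w@(wf-lam (wf-era wM _) x∈) =
  wf-era (wf-lam wM (∈-∷-≢ x∈ x≢y)) (proj₁ (Unique-∷⁻ (subst Unique fv≡ (wf-unique w)))) , ≡⇒≐ fv≡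
  where
  fv≡ : remove x (y ∷ fv M) ≡ y ∷ remove x (fv M)
  fv≡ = remove-there (fv M) x≢y

eraAppL-pres : ∀ {x M N} → app (era x M) N ▷ era x (app M N)
eraAppL-pres {x} {M} w@(wf-app (wf-era wM _) wN _) =
  wf-era (wf-app wM wN (Unique-++⇒Disjoint (fv M) (proj₂ (Unique-∷⁻ u)))) (proj₁ (Unique-∷⁻ u)) , id , id
  where u = wf-unique w

eraAppR-pres : ∀ {x M N} → app M (era x N) ▷ era x (app M N)
eraAppR-pres {x} {M} {N} w@(wf-app wM (wf-era wN _) _) =
  wf-era (wf-app wM wN (Unique-++⇒Disjoint (fv M) (proj₂ (Unique-∷⁻ u)))) (proj₁ (Unique-∷⁻ u)) , ↭⇒≐ perm
  where
  perm : fv M ++ x ∷ fv N ↭ x ∷ fv M ++ fv N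
  perm = shift x (fv M) (fv N)
  u = Unique-resp-↭ perm (wf-unique w)

dupEra-pres : ∀ {x x1 x2 y M} → y ≢ x1 → y ≢ x2 → dup x x1 x2 (era y M) ▷ era y (dup x x1 x2 M)
dupEra-pres {x} {x1} {x2} {y} {M} y≢x1 y≢x2 w@(wf-dup (wf-era wM _) x1∈ x2∈ x1≢x2 _) =
  wf-era (wf-dup wM (∈-∷-≢ x1∈ (≢-sym y≢x1)) (∈-∷-≢ x2∈ (≢-sym y≢x2)) x1≢x2
                 (proj₁ (Unique-∷⁻ (proj₂ (Unique-∷⁻ u)))))
         (proj₁ (Unique-∷⁻ u)) ,
  ↭⇒≐ perm
  where
  perm : fv (dup x x1 x2 (era y M)) ↭ fv (era y (dup x x1 x2 M))
  perm = begin
    x ∷ remove x2 (remove x1 (y ∷ fv M)) ≡⟨ cong (x ∷_) (remove₂-there (fv M) (≢-sym y≢x1) (≢-sym y≢x2)) ⟩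
    x ∷ y ∷ remove x2 (remove x1 (fv M)) ↭⟨ ↭-swap x y ↭-refl ⟩
    y ∷ x ∷ remove x2 (remove x1 (fv M)) ∎
    where open PermutationReasoning
  u = Unique-resp-↭ perm (wf-unique w)

dupGc-pres : ∀ {x x1 x2 M P} → Subst M (var x) x2 P → dup x x1 x2 (era x1 M) ▷ P
dupGc-pres {x} {x1} {x2} {M} s (wf-dup (wf-era _ x1∉M) _ _ _ _) =
  let (wP , fv≐) = Subst-pres s in wP , ≐-trans (↭⇒≐ perm) fv≐
  where
  perm : fv (dup x x1 x2 (era x1 M)) ↭ remove x2 (fv M) ++ x ∷ []
  perm = begin
    x ∷ remove x2 (remove x1 (x1 ∷ fv M)) ≡⟨ cong (λ L → x ∷ remove x2 L) (trans (remove-here x1 (fv M)) (remove-∉ (fv M) x1∉M)) ⟩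
    x ∷ remove x2 (fv M)                   ↭⟨ ++-comm (x ∷ []) (remove x2 (fv M)) ⟩
    remove x2 (fv M) ++ x ∷ []             ∎
    where open PermutationReasoning

⟶₀-pres : ∀ {M N} → M ⟶₀ N → M ▷ N
⟶₀-pres (r-β s) = β-pres s
⟶₀-pres (r-dupLam y≢x y≢x1 y≢x2) = dupLam-pres y≢x y≢x1 y≢x2
⟶₀-pres (r-dupAppL x1∉N x2∉N) = dupAppL-pres x1∉N x2∉N
⟶₀-pres (r-dupAppR x1∉M x2∉M) = dupAppR-pres x1∉M x2∉M
⟶₀-pres (r-lamEra x≢y) = lamEra-pres x≢y
⟶₀-pres r-eraAppL = eraAppL-pres
⟶₀-pres r-eraAppR = eraAppR-pres
⟶₀-pres (r-dupEra y≢x1 y≢x2) = dupEra-pres y≢x1 y≢x2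
⟶₀-pres (r-dupGc s) = dupGc-pres s

⟶c-pres : ∀ {M N} → M ⟶c N → M ▷ N
⟶c-pres (c-base r) = ⟶₀-pres r
⟶c-pres (c-lam r)  = ▷-lam (⟶c-pres r)
⟶c-pres (c-appL r) = ▷-app (⟶c-pres r) ▷-refl
⟶c-pres (c-appR r) = ▷-app ▷-refl (⟶c-pres r)
⟶c-pres (c-era r)  = ▷-era (⟶c-pres r)
⟶c-pres (c-dup r)  = ▷-dup (⟶c-pres r)

⟶-pres : ∀ {M N} → M ⟶ N → M ▷ N
⟶-pres (_ , _ , M≈M′ , M′⟶N′ , N′≈N) =
  ▷-trans (proj₁ (≈-pres M≈M′)) (▷-trans (⟶c-pres M′⟶N′) (proj₁ (≈-pres N′≈N)))

↠-pres : ∀ {M N} → M ↠ N → M ▷ N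
↠-pres ε        = ▷-refl
↠-pres (r ◅ rs) = ▷-trans (⟶-pres r) (↠-pres rs)

mainTheorem9 : (∀ M N → WF M → M ⟶ N → WF N) × (∀ M N → WF M → M ↠ N → WF N)
mainTheorem9 = (λ M N w r → proj₁ (⟶-pres r w)) , (λ M N w rs → proj₁ (↠-pres rs w))
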